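{- For any pseudodiagram $P$, the positions $P$ and $P\#*\#*$ have the same outcome in the knotting-unknotting game.
   Context: A knot pseudodiagram is a knot projection in which each crossing is resolved or unresolved, taken up to planar isotopy and Reidemeister moves; $\#$ is connected sum. In the knotting-unknotting game the Knotter and Unknotter alternately resolve one unresolved crossing; when none remain, the Unknotter wins iff the knot is the unknot. The outcome of a position is $U$ (Unknotter wins whoever starts), $K$ (Knotter wins whoever starts), $1$ (first player wins) or $2$ (second player wins). $*$ is the one-crossing kink diagram of the unknot with its crossing unresolved. -}

module Defs where

-- Knot pseudodiagrams encoded by (decorated) Gauss words.

open import Data.Nat using (ℕ; zero; suc; _+_; _*_; _∸_; _⊓_; _%_; _/_; _≡ᵇ_)
open import Data.Bool using (Bool; true; false; if_then_else_; _∧_; not)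
open import Data.List using (List; []; _∷_; _++_; length)
open import Data.List.Relation.Unary.All using (All)
open import Data.Maybe using (Maybe; just; nothing; fromMaybe)
open import Data.Product using (Σ; _×_; _,_; ∃)
open import Data.Sum using (_⊎_)
open import Data.Unit using (⊤)
open import Relation.Nullary using (¬_)
open import Relation.Binary.PropositionalEquality using (_≡_; _≢_)
open import Relation.Binary.Construct.Closure.ReflexiveTransitive using (Star)
open import Function.Bundles using (_⇔_)

data Status : Set where
  unres over under : Status

-- One passage of the (oriented, based) curve through a crossing.
--  label : name of the crossing (each crossing is passed exactly twice)
--  delta : true iff the other strand of the crossing crosses this
--          passage from its right to its left (shadow / rotation data)
--  st    : over/under information (or unresolved)
record Letter : Set where
  constructor mkL
  field
    label : ℕ
    delta : Bool
    st    : Status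
open Letter public

Word : Set
Word = List Letter

data Coherent : Status → Status → Set where
  uu : Coherent unres unres
  ou : Coherent over under
  uo : Coherent under over

countLabel : ℕ → Word → ℕ
countLabel ℓ [] = 0
countLabel ℓ (x ∷ w) = if label x ≡ᵇ ℓ then suc (countLabel ℓ w) else countLabel ℓ w

record WellFormed (w : Word) : Set where
  field
    twice  : All (λ x → countLabel (label x) w ≡ 2) w
    compat : ∀ u v t x y → w ≡ u ++ x ∷ v ++ y ∷ t → label x ≡ label y →
             (delta x ≢ delta y) × Coherent (st x) (st y)

-- Planarity (genus 0) of the underlying 4-valent curve, via Euler's formula.
-- Darts: 2i = outgoing end at passage i, 2i+1 = incoming end at passage i.

dflt : Letter
dflt = mkL 0 true unres

at : Word → ℕ → Letter
at [] _ = dflt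
at (x ∷ w) zero = x
at (x ∷ w) (suc n) = at w n

findPartner : ℕ → ℕ → ℕ → Word → Maybe ℕ
findPartner ℓ i j [] = nothing
findPartner ℓ i j (x ∷ w) =
  if (label x ≡ᵇ ℓ) ∧ not (j ≡ᵇ i) then just j else findPartner ℓ i (suc j) w

partner : Word → ℕ → ℕ
partner w i = fromMaybe i (findPartner (label (at w i)) i 0 w)

-- edge involution, for a word of length suc k
alpha : ℕ → ℕ → ℕ
alpha k d =
  if d % 2 ≡ᵇ 0
  then suc (2 * (suc (d / 2) % suc k))
  else 2 * ((d / 2 + k) % suc k)

-- counterclockwise rotation at the crossings
sigma : Word → ℕ → ℕ
sigma w d =
  let p = d / 2 ; q = partner w p ; δ = delta (at w p) in
  if d % 2 ≡ᵇ 0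
  then (if δ then 2 * q else suc (2 * q))
  else (if δ then suc (2 * q) else 2 * q)

iter : (ℕ → ℕ) → ℕ → ℕ → ℕ
iter f zero x = x
iter f (suc n) x = iter f n (f x)

minOrb : (ℕ → ℕ) → ℕ → ℕ → ℕ
minOrb f zero x = x
minOrb f (suc n) x = x ⊓ minOrb f n (f x)

countCycles : (ℕ → ℕ) → ℕ → ℕ → ℕ
countCycles f N zero = 0
countCycles f N (suc d) =
  if minOrb f N d ≡ᵇ d then suc (countCycles f N d) else countCycles f N d

-- number of faces (cycles of sigma ∘ alpha on the darts)
faces : Word → ℕ
faces [] = 0
faces w@(_ ∷ w') =
  let k = length w' ; N = 2 * suc k in
  countCycles (λ d → sigma w (alpha k d)) N N

-- genus 0:  V - E + F = 2  with  V = n, E = 2n, length w = 2n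
Planar : Word → Set
Planar [] = ⊤
Planar w@(_ ∷ _) = 2 * faces w ≡ length w + 4

Pseudodiagram : Word → Set
Pseudodiagram w = WellFormed w × Planar w

Resolved : Word → Set
Resolved w = All (λ x → st x ≢ unres) w

KnotDiagram : Word → Set
KnotDiagram w = Pseudodiagram w × Resolved w

-- Reidemeister moves (stated as reductions, closed up symmetrically below)

PairOn : ℕ → ℕ → Letter → Letter → Set
PairOn s t x y = (label x ≡ s × label y ≡ t) ⊎ (label x ≡ t × label y ≡ s)

data Move : Word → Word → Set where
  -- change of base point (planar isotopy)
  rot : ∀ u v → Move (u ++ v) (v ++ u)
  r1  : ∀ u v x y → label x ≡ label y → Move (u ++ x ∷ y ∷ v) (u ++ v)
  -- Reidemeister II: remove a bigon, one strand over both crossings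
  r2  : ∀ u v t x₁ y₁ x₂ y₂ → label x₁ ≢ label y₁ → st x₁ ≡ st y₁ →
        PairOn (label x₁) (label y₁) x₂ y₂ →
        Move (u ++ x₁ ∷ y₁ ∷ v ++ x₂ ∷ y₂ ∷ t) (u ++ v ++ t)
  -- Reidemeister III: slide a strand over a crossing (triangle with a top strand)
  r3  : ∀ u₁ u₂ u₃ u₄ x₁ y₁ x₂ y₂ x₃ y₃ a b c →
        a ≢ b → b ≢ c → a ≢ c →
        PairOn a b x₁ y₁ → PairOn b c x₂ y₂ → PairOn c a x₃ y₃ →
        ((st x₁ ≡ over × st y₁ ≡ over) ⊎ (st x₂ ≡ over × st y₂ ≡ over)
           ⊎ (st x₃ ≡ over × st y₃ ≡ over)) →
        Move (u₁ ++ x₁ ∷ y₁ ∷ u₂ ++ x₂ ∷ y₂ ∷ u₃ ++ x₃ ∷ y₃ ∷ u₄)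
             (u₁ ++ y₁ ∷ x₁ ∷ u₂ ++ y₂ ∷ x₂ ∷ u₃ ++ y₃ ∷ x₃ ∷ u₄)

EqStep : Word → Word → Set
EqStep w w' = KnotDiagram w × KnotDiagram w' × (Move w w' ⊎ Move w' w)

-- the knot diagram w represents the unknot: Reidemeister equivalent to
-- the crossingless circle (the empty Gauss word)
IsUnknot : Word → Set
IsUnknot w = Star EqStep w []

data Resolve : Word → Word → Set where
  res : ∀ u v t x y s s' → label x ≡ label y → st x ≡ unres → st y ≡ unres →
        Coherent s s' → s ≢ unres →
        Resolve (u ++ x ∷ v ++ y ∷ t)
                (u ++ mkL (label x) (delta x) s ∷ v ++ mkL (label y) (delta y) s' ∷ t)

data Player : Set where
  knotter unknotter : Player

data UWins : Player → Word → Set where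
  uEnd  : ∀ {p w} → Resolved w → IsUnknot w → UWins p w
  uMove : ∀ {w} w' → Resolve w w' → UWins knotter w' → UWins unknotter w
  kMove : ∀ {w} → ¬ Resolved w → (∀ w' → Resolve w w' → UWins unknotter w') →
          UWins knotter w

data KWins : Player → Word → Set where
  kEnd  : ∀ {p w} → Resolved w → ¬ IsUnknot w → KWins p w
  kMove : ∀ {w} w' → Resolve w w' → KWins unknotter w' → KWins knotter w
  uMove : ∀ {w} → ¬ Resolved w → (∀ w' → Resolve w w' → KWins knotter w') →
          KWins unknotter w

data Outcome : Set where
  U K first second : Outcome

HasOutcome : Word → Outcome → Set
HasOutcome w U      = UWins unknotter w × UWins knotter w
HasOutcome w K      = KWins unknotter w × KWins knotter w
HasOutcome w first  = UWins unknotter w × KWins knotter w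
HasOutcome w second = KWins unknotter w × UWins knotter w

-- Connected sum with * (unresolved one-crossing kink), at any point of
-- the diagram, with a fresh crossing label and either curl direction.

kink : ℕ → Bool → Word
kink c b = mkL c b unres ∷ mkL c (not b) unres ∷ []

data AddKink : Word → Word → Set where
  addKink : ∀ u v c b → countLabel c (u ++ v) ≡ 0 →
            AddKink (u ++ v) (u ++ kink c b ++ v)

module Submission where

-- Let Q₂ be Q with two inserted kinks.  A
-- player who wins from Q also wins from Q₂, and conversely: they copy their
-- strategy on the crossings of Q, and whenever the opponent resolves one of
-- the kinks they resolve the other one (pairing strategy); a move forced on
-- a finished Q is spent on a kink as well.  Once both kinks are resolved,
-- two Reidemeister I moves remove them, so the final diagrams of Q and Q₂
-- have the same knot type.
--
-- The Reidemeister I moves are steps between knot diagrams,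
-- so all intermediate words must be well-formed and planar, where Planar
-- is Euler's formula for the faces (cycles of the face map on darts).
-- Inserting a kink adds two letters and exactly one face.  This rests on a
-- removal lemma for permutations: deleting a point x (sending its
-- predecessor directly to its successor) keeps the number of cycles, except
-- that a fixed point x takes its cycle along.  The face map of the kinked
-- word is the old one with a block of four darts inserted, and deleting
-- these one at a time loses exactly one cycle.

open import Defs
open import Function.Bundles using (_⇔_; mk⇔; Equivalence)
open import Data.Nat
open import Data.Nat.Properties
open import Data.Nat.DivMod
open import Data.Bool using (Bool; true; false; if_then_else_; _∧_; not; T)
open import Data.Bool.Properties using (T-≡)
open import Data.List using ([]; _∷_; _++_; length)
open import Data.List.Properties using (length-++)
open import Data.List.Relation.Unary.All using (All; []; _∷_; all?)
open import Data.List.Relation.Unary.All.Properties using (++⁺; ++⁻ˡ; ++⁻ʳ)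
open import Data.Maybe using (just; fromMaybe)
open import Data.Product using (Σ; _×_; _,_; ∃; proj₁; proj₂)
open import Data.Product.Function.NonDependent.Propositional using (_×-⇔_)
open import Data.Sum using (_⊎_; inj₁; inj₂)
open import Data.Empty using (⊥; ⊥-elim)
open import Data.Unit using (tt)
open import Data.Fin using (Fin; toℕ; fromℕ<)
open import Data.Fin.Properties using (pigeonhole; toℕ-fromℕ<; toℕ<n)
open import Relation.Nullary using (¬_; Dec; yes; no)
open import Relation.Binary using (tri<; tri≈; tri>)
open import Relation.Binary.PropositionalEquality
open import Relation.Binary.Construct.Closure.ReflexiveTransitive using (_◅_)

T⇒≡true : ∀ {b} → T b → b ≡ true
T⇒≡true = Equivalence.to T-≡

¬T⇒≡false : ∀ {b} → ¬ T b → b ≡ false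
¬T⇒≡false {true} n = ⊥-elim (n tt)
¬T⇒≡false {false} _ = refl

T-ext : ∀ {a b} → (T a → T b) → (T b → T a) → a ≡ b
T-ext {true} {true} _ _ = refl
T-ext {true} {false} f _ = ⊥-elim (f tt)
T-ext {false} {true} _ f = ⊥-elim (f tt)
T-ext {false} {false} _ _ = refl

≡ᵇ-refl : ∀ a → (a ≡ᵇ a) ≡ true
≡ᵇ-refl a = T⇒≡true (≡⇒≡ᵇ a a refl)

≢⇒≡ᵇfalse : ∀ a b → a ≢ b → (a ≡ᵇ b) ≡ false
≢⇒≡ᵇfalse a b ne = ¬T⇒≡false (λ t → ne (≡ᵇ⇒≡ a b t))

<ᵇ-true : ∀ {a b} → a < b → (a <ᵇ b) ≡ true
<ᵇ-true lt = T⇒≡true (<⇒<ᵇ lt)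

<ᵇ-false : ∀ {a b} → b ≤ a → (a <ᵇ b) ≡ false
<ᵇ-false {a} {b} le = ¬T⇒≡false (λ t → <⇒≱ (<ᵇ⇒< a b t) le)

Maps : (ℕ → ℕ) → ℕ → Set
Maps f N = ∀ d → d < N → f d < N

Inj : (ℕ → ℕ) → ℕ → Set
Inj f N = ∀ d e → d < N → e < N → f d ≡ f e → d ≡ e

module _ (f : ℕ → ℕ) where
  iter-suc : ∀ n x → iter f (suc n) x ≡ f (iter f n x)
  iter-suc zero x = refl
  iter-suc (suc n) x = iter-suc n (f x)

  iter-+ : ∀ m n x → iter f (m + n) x ≡ iter f n (iter f m x)
  iter-+ zero n x = refl
  iter-+ (suc m) n x = iter-+ m n (f x)

  minOrb-le : ∀ n i x → i ≤ n → minOrb f n x ≤ iter f i x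
  minOrb-le zero .zero x z≤n = ≤-refl
  minOrb-le (suc n) zero x _ = m⊓n≤m x _
  minOrb-le (suc n) (suc i) x (s≤s i≤n) = ≤-trans (m⊓n≤n x _) (minOrb-le n i (f x) i≤n)

  minOrb-in : ∀ n x → ∃ λ i → i ≤ n × minOrb f n x ≡ iter f i x
  minOrb-in zero x = 0 , z≤n , refl
  minOrb-in (suc n) x with x ≤? minOrb f n (f x)
  ... | yes le = 0 , z≤n , m≤n⇒m⊓n≡m le
  ... | no nle with minOrb-in n (f x)
  ... | i , i≤n , eq = suc i , s≤s i≤n , trans (m≥n⇒m⊓n≡n (<⇒≤ (≰⇒> nle))) eq

  -- For a permutation of [0, N) every orbit is periodic of period ≤ N, so
  -- minOrb f N x is the minimum of the whole cycle of x.
  module Permutation (N : ℕ) (mp : Maps f N) (inj : Inj f N) where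
    iter-maps : ∀ n x → x < N → iter f n x < N
    iter-maps zero x x<N = x<N
    iter-maps (suc n) x x<N = iter-maps n (f x) (mp x x<N)

    iter-inj : ∀ a x y → x < N → y < N → iter f a x ≡ iter f a y → x ≡ y
    iter-inj zero x y _ _ eq = eq
    iter-inj (suc a) x y x<N y<N eq = inj x y x<N y<N (iter-inj a (f x) (f y) (mp x x<N) (mp y y<N) eq)

    -- pigeonhole on the first N+1 iterates, then cancel by injectivity
    period : ∀ x → x < N → ∃ λ p → 0 < p × p ≤ N × iter f p x ≡ x
    period x x<N with pigeonhole (n<1+n N) (λ (i : Fin (suc N)) → fromℕ< (iter-maps (toℕ i) x x<N))
    ... | i , j , i<j , eq = p , m<n⇒0<n∸m i<j , p≤N , cancel
      where
        a = toℕ i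
        b = toℕ j
        same : iter f a x ≡ iter f b x
        same = trans (sym (toℕ-fromℕ< (iter-maps a x x<N)))
                     (trans (cong toℕ eq) (toℕ-fromℕ< (iter-maps b x x<N)))
        p = b ∸ a
        p≤N : p ≤ N
        p≤N = ≤-trans (m∸n≤m b a) (≤-pred (toℕ<n j))
        b≡p+a : b ≡ p + a
        b≡p+a = sym (m∸n+n≡m (<⇒≤ i<j))
        cancel : iter f p x ≡ x
        cancel = sym (iter-inj a x (iter f p x) x<N (iter-maps p x x<N)
                   (trans same (trans (cong (λ z → iter f z x) b≡p+a) (iter-+ p a x))))

    reduce : ∀ x p → 0 < p → iter f p x ≡ x → ∀ k → ∃ λ r → r < p × iter f k x ≡ iter f r x
    reduce x p p>0 per zero = 0 , p>0 , refl
    reduce x p p>0 per (suc k) with reduce x p p>0 per k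
    ... | r , r<p , eq with m≤n⇒m<n∨m≡n r<p
    ... | inj₁ sr<p = suc r , sr<p , trans (iter-suc k x) (trans (cong f eq) (sym (iter-suc r x)))
    ... | inj₂ sr≡p = 0 , p>0 , trans (iter-suc k x) (trans (cong f eq)
                          (trans (sym (iter-suc r x)) (trans (cong (λ z → iter f z x) sr≡p) per)))

    minOrb-all : ∀ x → x < N → ∀ k → minOrb f N x ≤ iter f k x
    minOrb-all x x<N k with period x x<N
    ... | p , p>0 , p≤N , per with reduce x p p>0 per k
    ... | r , r<p , eq = subst (minOrb f N x ≤_) (sym eq) (minOrb-le N r x (≤-trans (<⇒≤ r<p) p≤N))

    -- d is the minimum of its cycle (the point that countCycles counts)
    IsMin : ℕ → Set
    IsMin d = ∀ k → d ≤ iter f k d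

    isMinᵇ : ℕ → Bool
    isMinᵇ d = minOrb f N d ≡ᵇ d

    isMinᵇ⇒IsMin : ∀ d → d < N → T (isMinᵇ d) → IsMin d
    isMinᵇ⇒IsMin d d<N t k = subst (_≤ iter f k d) (≡ᵇ⇒≡ _ _ t) (minOrb-all d d<N k)

    IsMin⇒isMinᵇ : ∀ d → IsMin d → T (isMinᵇ d)
    IsMin⇒isMinᵇ d P with minOrb-in N d
    ... | i , _ , eq = ≡⇒≡ᵇ _ _ (≤-antisym (minOrb-le N 0 d z≤n) (subst (d ≤_) (sym eq) (P i)))

    notMin⇒smaller : ∀ d → ¬ T (isMinᵇ d) → ∃ λ i → iter f i d < d
    notMin⇒smaller d nt with minOrb-in N d
    ... | i , _ , eq = i , subst (_< d) eq (≤∧≢⇒< (minOrb-le N 0 d z≤n) (λ e → nt (≡⇒≡ᵇ _ _ e)))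

    iter-mult : ∀ x p → iter f p x ≡ x → ∀ a → iter f (a * p) x ≡ x
    iter-mult x p per zero = refl
    iter-mult x p per (suc a) = trans (iter-+ p (a * p) x) (trans (cong (iter f (a * p)) per) (iter-mult x p per a))

    back : ∀ x m → x < N → ∃ λ k → iter f k (iter f m x) ≡ x
    back x m x<N with period x x<N
    ... | zero , () , _
    ... | suc p' , _ , _ , per = p' * m , trans (sym (iter-+ m (p' * m) x))
                                   (trans (cong (λ z → iter f z x) (*-comm (suc p') m)) (iter-mult x (suc p') per m))

    minOrb-isMin : ∀ x → x < N → T (isMinᵇ (minOrb f N x))
    minOrb-isMin x x<N with minOrb-in N x
    ... | i , _ , eq = IsMin⇒isMinᵇ _ λ k → subst (λ z → z ≤ iter f k z) (sym eq)
                         (subst (iter f i x ≤_) (iter-+ i k x) (subst (_≤ iter f (i + k) x) eq (minOrb-all x x<N (i + k))))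

minOrb-ext : ∀ f f' N → Maps f N → (∀ d → d < N → f d ≡ f' d) → ∀ n x → x < N → minOrb f n x ≡ minOrb f' n x
minOrb-ext f f' N mp ext zero x _ = refl
minOrb-ext f f' N mp ext (suc n) x x<N rewrite minOrb-ext f f' N mp ext n (f x) (mp x x<N) | ext x x<N = refl

countCycles-ext : ∀ f f' N → Maps f N → (∀ d → d < N → f d ≡ f' d) → ∀ n → n ≤ N → countCycles f N n ≡ countCycles f' N n
countCycles-ext f f' N mp ext zero _ = refl
countCycles-ext f f' N mp ext (suc n) sn≤N
  rewrite minOrb-ext f f' N mp ext N n sn≤N | countCycles-ext f f' N mp ext n (≤-trans (n≤1+n n) sn≤N) = refl

minOrb-cong : ∀ f f' → (∀ d → f d ≡ f' d) → ∀ n x → minOrb f n x ≡ minOrb f' n x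
minOrb-cong f f' e zero x = refl
minOrb-cong f f' e (suc n) x rewrite e x | minOrb-cong f f' e n (f' x) = refl

countCycles-cong : ∀ f f' → (∀ d → f d ≡ f' d) → ∀ N n → countCycles f N n ≡ countCycles f' N n
countCycles-cong f f' e N zero = refl
countCycles-cong f f' e N (suc n) rewrite minOrb-cong f f' e N n | countCycles-cong f f' e N n = refl

countBelow : (ℕ → Bool) → ℕ → ℕ
countBelow b zero = 0
countBelow b (suc n) = if b n then suc (countBelow b n) else countBelow b n

countCycles≡countBelow : ∀ f N n → countCycles f N n ≡ countBelow (λ d → minOrb f N d ≡ᵇ d) n
countCycles≡countBelow f N zero = refl
countCycles≡countBelow f N (suc n) with minOrb f N n ≡ᵇ n
... | true = cong suc (countCycles≡countBelow f N n)
... | false = countCycles≡countBelow f N n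

countBelow-ext : ∀ (a b : ℕ → Bool) n → (∀ d → d < n → a d ≡ b d) → countBelow a n ≡ countBelow b n
countBelow-ext a b zero h = refl
countBelow-ext a b (suc n) h with a n | b n | h n ≤-refl | countBelow-ext a b n (λ d d<n → h d (m<n⇒m<1+n d<n))
... | true | true | _ | ih = cong suc ih
... | false | false | _ | ih = ih
... | true | false | () | _
... | false | true | () | _

countBelow-one : ∀ (a b : ℕ → Bool) n d* → d* < n → a d* ≡ false → b d* ≡ true →
                 (∀ d → d < n → d ≢ d* → a d ≡ b d) → countBelow b n ≡ suc (countBelow a n)
countBelow-one a b zero d* () _ _ _
countBelow-one a b (suc n) d* d*<sn ad bd h with n ≟ d*
... | yes refl rewrite ad | bd = cong suc (sym (countBelow-ext a b n (λ d d<n → h d (m<n⇒m<1+n d<n) (λ e → <-irrefl e d<n))))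
... | no n≢d with a n | b n | h n ≤-refl n≢d
        | countBelow-one a b n d* (≤∧≢⇒< (≤-pred d*<sn) (λ e → n≢d (sym e))) ad bd (λ d d<n → h d (m<n⇒m<1+n d<n))
... | true | true | _ | ih = cong suc ih
... | false | false | _ | ih = ih
... | true | false | () | _
... | false | true | () | _

countBelow-suc-cong : ∀ (a b : ℕ → Bool) n m → a n ≡ b m → countBelow a n ≡ countBelow b m → countBelow a (suc n) ≡ countBelow b (suc m)
countBelow-suc-cong a b n m eq ih with a n | b m
... | true | true = cong suc ih
... | false | false = ih
... | true | false = ⊥-elim (case eq)
  where case : true ≡ false → ⊥
        case ()
... | false | true = ⊥-elim (case eq)
  where case : false ≡ true → ⊥
        case ()

-- Deleting the point x from [0, M+1) and renumbering the remaining points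
-- as [0, M): squeeze x is the renumbering, stretch x its inverse.

module Renumber (x : ℕ) where
  squeeze : ℕ → ℕ
  squeeze d = if d <ᵇ x then d else pred d

  stretch : ℕ → ℕ
  stretch D = if D <ᵇ x then D else suc D

  squeeze-below : ∀ d → d < x → squeeze d ≡ d
  squeeze-below d d<x rewrite <ᵇ-true d<x = refl

  squeeze-above : ∀ d → x < d → squeeze d ≡ pred d
  squeeze-above d x<d rewrite <ᵇ-false (<⇒≤ x<d) = refl

  stretch-below : ∀ D → D < x → stretch D ≡ D
  stretch-below D D<x rewrite <ᵇ-true D<x = refl

  stretch-above : ∀ D → x ≤ D → stretch D ≡ suc D
  stretch-above D x≤D rewrite <ᵇ-false x≤D = refl

  squeeze-bound : ∀ {M} → x < suc M → ∀ d → d < suc M → d ≢ x → squeeze d < M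
  squeeze-bound x<sM d d<sM d≢x with <-cmp d x
  ... | tri< d<x _ _ rewrite squeeze-below d d<x = <-≤-trans d<x (≤-pred x<sM)
  ... | tri≈ _ d≡x _ = ⊥-elim (d≢x d≡x)
  ... | tri> _ _ x<d rewrite squeeze-above d x<d with d | x<d | d<sM
  ... | suc d' | _ | s≤s d'<M = d'<M

  stretch-bound : ∀ {M} D → D < M → stretch D < suc M
  stretch-bound D D<M with D <? x
  ... | yes D<x rewrite stretch-below D D<x = m<n⇒m<1+n D<M
  ... | no D≮x rewrite stretch-above D (≮⇒≥ D≮x) = s≤s D<M

  stretch-≢ : ∀ D → stretch D ≢ x
  stretch-≢ D with D <? x
  ... | yes D<x rewrite stretch-below D D<x = <⇒≢ D<x
  ... | no D≮x rewrite stretch-above D (≮⇒≥ D≮x) = λ eq → D≮x (subst (D <_) eq ≤-refl)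

  squeeze-stretch : ∀ D → squeeze (stretch D) ≡ D
  squeeze-stretch D with D <? x
  ... | yes D<x rewrite stretch-below D D<x = squeeze-below D D<x
  ... | no D≮x rewrite stretch-above D (≮⇒≥ D≮x) = squeeze-above (suc D) (s≤s (≮⇒≥ D≮x))

  stretch-squeeze : ∀ d → d ≢ x → stretch (squeeze d) ≡ d
  stretch-squeeze d d≢x with <-cmp d x
  ... | tri< d<x _ _ rewrite squeeze-below d d<x = stretch-below d d<x
  ... | tri≈ _ d≡x _ = ⊥-elim (d≢x d≡x)
  ... | tri> _ _ x<d rewrite squeeze-above d x<d with d | x<d
  ... | suc d' | s≤s x≤d' = stretch-above d' x≤d'

  squeeze-reflects-≤ : ∀ a b → a ≢ x → b ≢ x → squeeze a ≤ squeeze b → a ≤ b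
  squeeze-reflects-≤ a b a≢x b≢x le with <-cmp a x | <-cmp b x
  ... | tri≈ _ eq _ | _ = ⊥-elim (a≢x eq)
  ... | _ | tri≈ _ eq _ = ⊥-elim (b≢x eq)
  ... | tri< a<x _ _ | tri< b<x _ _ rewrite squeeze-below a a<x | squeeze-below b b<x = le
  ... | tri< a<x _ _ | tri> _ _ x<b = <⇒≤ (<-trans a<x x<b)
  ... | tri> _ _ x<a | tri< b<x _ _ rewrite squeeze-above a x<a | squeeze-below b b<x =
        ⊥-elim (<-irrefl refl (<-≤-trans b<x (≤-trans (≤-pred (subst (x <_) (sym (suc-pred a {{>-nonZero (≤-<-trans z≤n x<a)}})) x<a)) le)))
  ... | tri> _ _ x<a | tri> _ _ x<b rewrite squeeze-above a x<a | squeeze-above b x<b with a | b | x<a | x<b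
  ... | suc a' | suc b' | _ | _ = s≤s le

  squeeze-mono-≤ : ∀ a b → a ≢ x → b ≢ x → a ≤ b → squeeze a ≤ squeeze b
  squeeze-mono-≤ a b a≢x b≢x le with <-cmp a x | <-cmp b x
  ... | tri≈ _ eq _ | _ = ⊥-elim (a≢x eq)
  ... | _ | tri≈ _ eq _ = ⊥-elim (b≢x eq)
  ... | tri< a<x _ _ | tri< b<x _ _ rewrite squeeze-below a a<x | squeeze-below b b<x = le
  ... | tri< a<x _ _ | tri> _ _ x<b rewrite squeeze-below a a<x | squeeze-above b x<b = <⇒≤pred (<-trans a<x x<b)
  ... | tri> _ _ x<a | tri< b<x _ _ = ⊥-elim (<-irrefl refl (<-≤-trans b<x (≤-trans (<⇒≤ x<a) le)))
  ... | tri> _ _ x<a | tri> _ _ x<b rewrite squeeze-above a x<a | squeeze-above b x<b = pred-mono-≤ le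

  squeeze-inj : ∀ a b → a ≢ x → b ≢ x → squeeze a ≡ squeeze b → a ≡ b
  squeeze-inj a b a≢x b≢x eq = ≤-antisym (squeeze-reflects-≤ a b a≢x b≢x (≤-reflexive eq)) (squeeze-reflects-≤ b a b≢x a≢x (≤-reflexive (sym eq)))

-- The permutation obtained from g by deleting the point x: the predecessor
-- of x is sent directly to g x.

bypass : (ℕ → ℕ) → ℕ → ℕ → ℕ
bypass g x D = squeeze (if g (stretch D) ≡ᵇ x then g x else g (stretch D))
  where open Renumber x

-- Removal lemma: deleting a point x from a permutation g of [0, M+1) keeps
-- the number of cycles, except that a fixed point x takes its cycle along.
-- A point d ≢ x is the minimum of its h-cycle iff it is the minimum of its
-- g-cycle, except when x is the minimum of its (non-trivial) cycle; then
-- exactly one new minimum d* appears in that cycle.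

module Removal (g : ℕ → ℕ) (M x : ℕ) (x<sM : x < suc M)
               (maps-g : Maps g (suc M)) (inj-g : Inj g (suc M)) where
  open Renumber x

  h : ℕ → ℕ
  h = bypass g x

  h-skip : ∀ d → d < suc M → d ≢ x → g d ≢ x → h (squeeze d) ≡ squeeze (g d)
  h-skip d _ d≢x gd≢x rewrite stretch-squeeze d d≢x | ≢⇒≡ᵇfalse (g d) x gd≢x = refl

  h-jump : ∀ d → d < suc M → d ≢ x → g d ≡ x → h (squeeze d) ≡ squeeze (g x)
  h-jump d _ d≢x gd≡x rewrite stretch-squeeze d d≢x | gd≡x | ≡ᵇ-refl x = refl

  module Reindex (β : ℕ → Bool) where
    γ : ℕ → Bool
    γ d = not (d ≡ᵇ x) ∧ β (squeeze d)

    reindex-below : ∀ n → n ≤ x → countBelow γ n ≡ countBelow β n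
    reindex-below zero _ = refl
    reindex-below (suc n) sn≤x = countBelow-suc-cong γ β n n
      (trans (cong (λ z → not z ∧ β (squeeze n)) (≢⇒≡ᵇfalse n x (<⇒≢ sn≤x))) (cong β (squeeze-below n sn≤x)))
      (reindex-below n (≤-trans (n≤1+n n) sn≤x))

    reindex-above : ∀ n → x ≤ n → countBelow γ (suc n) ≡ countBelow β n
    reindex-above n x≤n with m≤n⇒m<n∨m≡n x≤n
    ... | inj₂ refl rewrite ≡ᵇ-refl x = reindex-below x ≤-refl
    ... | inj₁ x<n with n | x<n
    ... | suc n' | s≤s x≤n' = countBelow-suc-cong γ β (suc n') n'
          (trans (cong (λ z → not z ∧ β (squeeze (suc n'))) (≢⇒≡ᵇfalse (suc n') x (λ eq → <-irrefl (sym eq) (s≤s x≤n'))))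
                 (cong β (squeeze-above (suc n') (s≤s x≤n'))))
          (reindex-above n' x≤n')

    reindex : countBelow β M ≡ countBelow γ (suc M)
    reindex = sym (reindex-above M (≤-pred x<sM))

  countBelow-split : ∀ (a : ℕ → Bool) → countBelow a (suc M) ≡ countBelow (λ d → not (d ≡ᵇ x) ∧ a d) (suc M) + (if a x then 1 else 0)
  countBelow-split a with a x in ax
  ... | false = trans (countBelow-ext a a' (suc M) eqs) (sym (+-identityʳ _))
    where
      a' = λ d → not (d ≡ᵇ x) ∧ a d
      eqs : ∀ d → d < suc M → a d ≡ a' d
      eqs d _ with d ≟ x
      ... | yes refl rewrite ≡ᵇ-refl x = ax
      ... | no d≢x rewrite ≢⇒≡ᵇfalse d x d≢x = refl
  ... | true = trans (countBelow-one a' a (suc M) x x<sM a'x ax eqs) (+-comm 1 _)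
    where
      a' = λ d → not (d ≡ᵇ x) ∧ a d
      a'x : a' x ≡ false
      a'x rewrite ≡ᵇ-refl x = refl
      eqs : ∀ d → d < suc M → d ≢ x → a' d ≡ a d
      eqs d _ d≢x rewrite ≢⇒≡ᵇfalse d x d≢x = refl

  module G = Permutation g (suc M) maps-g inj-g

  gx≢x : ∀ d → d < suc M → d ≢ x → g d ≡ x → g x ≢ x
  gx≢x d d<sM d≢x gd≡x gx≡x = d≢x (inj-g d x d<sM x<sM (trans gd≡x (sym gx≡x)))

  iter-fix : g x ≡ x → ∀ j → iter g j x ≡ x
  iter-fix fx zero = refl
  iter-fix fx (suc j) = trans (cong (iter g j) fx) (iter-fix fx j)

  fixed-pre : g x ≡ x → ∀ d j → d < suc M → iter g j d ≡ x → d ≡ x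
  fixed-pre fx d j d<sM eq = G.iter-inj j d x d<sM x<sM (trans eq (sym (iter-fix fx j)))

  record HStep (d : ℕ) : Set where
    field
      z : ℕ
      hz : h (squeeze d) ≡ squeeze z
      z≢x : z ≢ x
      z< : z < suc M
      which : (g d ≢ x × g d ≡ z) ⊎ (g d ≡ x × g x ≡ z)

  h-step : ∀ d → d < suc M → d ≢ x → HStep d
  h-step d d<sM d≢x with g d ≟ x
  ... | no gd≢x = record { z = g d ; hz = h-skip d d<sM d≢x gd≢x ; z≢x = gd≢x ; z< = maps-g d d<sM ; which = inj₁ (gd≢x , refl) }
  ... | yes gd≡x = record { z = g x ; hz = h-jump d d<sM d≢x gd≡x ; z≢x = gx≢x d d<sM d≢x gd≡x ; z< = maps-g x x<sM ; which = inj₂ (gd≡x , refl) }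

  maps-h : Maps h M
  maps-h D D<M = subst (_< M) (sym (trans (cong h (sym (squeeze-stretch D))) (HStep.hz s)))
                (squeeze-bound x<sM (HStep.z s) (HStep.z< s) (HStep.z≢x s))
    where s = h-step (stretch D) (stretch-bound D D<M) (stretch-≢ D)

  inj-h : Inj h M
  inj-h D₁ D₂ D₁<M D₂<M eq = trans (sym (squeeze-stretch D₁)) (trans (cong squeeze deq) (squeeze-stretch D₂))
    where
      d₁ = stretch D₁
      d₂ = stretch D₂
      d₁< = stretch-bound D₁ D₁<M
      d₂< = stretch-bound D₂ D₂<M
      s₁ = h-step d₁ d₁< (stretch-≢ D₁)
      s₂ = h-step d₂ d₂< (stretch-≢ D₂)
      zeq : HStep.z s₁ ≡ HStep.z s₂
      zeq = squeeze-inj _ _ (HStep.z≢x s₁) (HStep.z≢x s₂)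
             (trans (sym (HStep.hz s₁)) (trans (cong h (squeeze-stretch D₁)) (trans eq (trans (cong h (sym (squeeze-stretch D₂))) (HStep.hz s₂)))))
      deq : d₁ ≡ d₂
      deq with HStep.which s₁ | HStep.which s₂
      ... | inj₁ (_ , e₁) | inj₁ (_ , e₂) = inj-g d₁ d₂ d₁< d₂< (trans e₁ (trans zeq (sym e₂)))
      ... | inj₂ (g₁ , _) | inj₂ (g₂ , _) = inj-g d₁ d₂ d₁< d₂< (trans g₁ (sym g₂))
      ... | inj₁ (n₁ , e₁) | inj₂ (g₂ , e₂) = ⊥-elim (stretch-≢ D₁ (inj-g d₁ x d₁< x<sM (trans e₁ (trans zeq (sym e₂)))))
      ... | inj₂ (g₁ , e₁) | inj₁ (n₂ , e₂) = ⊥-elim (stretch-≢ D₂ (inj-g d₂ x d₂< x<sM (trans e₂ (trans (sym zeq) (sym e₁)))))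

  module H = Permutation h M maps-h inj-h

  h-orbit⊆g-orbit : ∀ d → d < suc M → d ≢ x → ∀ j → ∃ λ j' → iter h j (squeeze d) ≡ squeeze (iter g j' d) × iter g j' d ≢ x
  h-orbit⊆g-orbit d d<sM d≢x zero = 0 , refl , d≢x
  h-orbit⊆g-orbit d d<sM d≢x (suc j) with h-orbit⊆g-orbit d d<sM d≢x j
  ... | j' , eq , ne with h-step (iter g j' d) (G.iter-maps j' d d<sM) ne
  ... | s with HStep.which s
  ... | inj₁ (_ , gz) = suc j' , trans (iter-suc h j (squeeze d)) (trans (cong h eq) (trans (HStep.hz s)
                            (cong squeeze (trans (sym gz) (sym (iter-suc g j' d)))))) ,
                        subst (_≢ x) (trans gz' (sym (iter-suc g j' d))) (HStep.z≢x s)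
    where gz' = sym gz
  ... | inj₂ (gz≡x , gx) = suc (suc j') , trans (iter-suc h j (squeeze d)) (trans (cong h eq) (trans (HStep.hz s)
                            (cong squeeze (trans (sym gx) (trans (cong g (sym gz≡x))
                              (trans (cong g (sym (iter-suc g j' d))) (sym (iter-suc g (suc j') d)))))))) ,
                        subst (_≢ x) (trans (sym gx) (trans (cong g (sym gz≡x))
                              (trans (cong g (sym (iter-suc g j' d))) (sym (iter-suc g (suc j') d))))) (HStep.z≢x s)

  g-orbit⊆h-orbit : ∀ d → d < suc M → d ≢ x → ∀ j' →
          (iter g j' d ≢ x → ∃ λ j → iter h j (squeeze d) ≡ squeeze (iter g j' d)) ×
          (iter g j' d ≡ x → ∃ λ j → iter h j (squeeze d) ≡ squeeze (g x))
  g-orbit⊆h-orbit d d<sM d≢x zero = (λ _ → 0 , refl) , (λ eq → ⊥-elim (d≢x eq))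
  g-orbit⊆h-orbit d d<sM d≢x (suc j') with g-orbit⊆h-orbit d d<sM d≢x j' | iter g j' d ≟ x
  ... | c1 , c2 | no z≢x = comp1 , comp2
    where
      z = iter g j' d
      z< = G.iter-maps j' d d<sM
      jj = proj₁ (c1 z≢x)
      eqj = proj₂ (c1 z≢x)
      comp1 : iter g (suc j') d ≢ x → ∃ λ j → iter h j (squeeze d) ≡ squeeze (iter g (suc j') d)
      comp1 ne = suc jj , trans (iter-suc h jj (squeeze d)) (trans (cong h eqj)
                    (trans (h-skip z z< z≢x (subst (_≢ x) (iter-suc g j' d) ne)) (cong squeeze (sym (iter-suc g j' d)))))
      comp2 : iter g (suc j') d ≡ x → ∃ λ j → iter h j (squeeze d) ≡ squeeze (g x)
      comp2 eq = suc jj , trans (iter-suc h jj (squeeze d)) (trans (cong h eqj)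
                    (h-jump z z< z≢x (trans (sym (iter-suc g j' d)) eq)))
  ... | c1 , c2 | yes z≡x = comp1 , comp2
    where
      comp1 : iter g (suc j') d ≢ x → ∃ λ j → iter h j (squeeze d) ≡ squeeze (iter g (suc j') d)
      comp1 ne = proj₁ (c2 z≡x) , trans (proj₂ (c2 z≡x)) (cong squeeze (trans (cong g (sym z≡x)) (sym (iter-suc g j' d))))
      comp2 : iter g (suc j') d ≡ x → ∃ λ j → iter h j (squeeze d) ≡ squeeze (g x)
      comp2 eq = ⊥-elim (d≢x (fixed-pre (trans (cong g (sym z≡x)) (trans (sym (iter-suc g j' d)) eq)) d j' d<sM z≡x))

  MinAwayFromX : ℕ → Set
  MinAwayFromX d = ∀ k → iter g k d ≢ x → d ≤ iter g k d

  hMin⇒minAway : ∀ d → d < suc M → d ≢ x → H.IsMin (squeeze d) → MinAwayFromX d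
  hMin⇒minAway d d<sM d≢x P k ne with proj₁ (g-orbit⊆h-orbit d d<sM d≢x k) ne
  ... | j , eq = squeeze-reflects-≤ d (iter g k d) d≢x ne (subst (squeeze d ≤_) eq (P j))

  minAway⇒hMin : ∀ d → d < suc M → d ≢ x → MinAwayFromX d → H.IsMin (squeeze d)
  minAway⇒hMin d d<sM d≢x R j with h-orbit⊆g-orbit d d<sM d≢x j
  ... | j' , eq , ne = subst (squeeze d ≤_) (sym eq) (squeeze-mono-≤ d (iter g j' d) d≢x ne (R j' ne))

  gMinᵇ : ℕ → Bool
  gMinᵇ = G.isMinᵇ
  hMinᵇ : ℕ → Bool
  hMinᵇ = H.isMinᵇ

  gMin⇒hMin : ∀ d → d < suc M → d ≢ x → T (gMinᵇ d) → T (hMinᵇ (squeeze d))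
  gMin⇒hMin d d<sM d≢x t = H.IsMin⇒isMinᵇ (squeeze d) (minAway⇒hMin d d<sM d≢x (λ k _ → G.isMinᵇ⇒IsMin d d<sM t k))

  hMinᵇ⇒minAway : ∀ d → d < suc M → d ≢ x → T (hMinᵇ (squeeze d)) → MinAwayFromX d
  hMinᵇ⇒minAway d d<sM d≢x t = hMin⇒minAway d d<sM d≢x (H.isMinᵇ⇒IsMin (squeeze d) (squeeze-bound x<sM d d<sM d≢x) t)

  gMin≡hMin : (g x ≡ x ⊎ ¬ T (gMinᵇ x)) → ∀ d → d < suc M → d ≢ x → gMinᵇ d ≡ hMinᵇ (squeeze d)
  gMin≡hMin cond d d<sM d≢x = T-ext (gMin⇒hMin d d<sM d≢x) back'
    where
      back' : T (hMinᵇ (squeeze d)) → T (gMinᵇ d)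
      back' t = G.IsMin⇒isMinᵇ d P
        where
          R = hMinᵇ⇒minAway d d<sM d≢x t
          P : G.IsMin d
          P k with iter g k d ≟ x
          ... | no ne = R k ne
          ... | yes eq with d ≤? x
          ... | yes d≤x = subst (d ≤_) (sym eq) d≤x
          ... | no d≰x = ⊥-elim (contra cond)
            where
              x<d = ≰⇒> d≰x
              contra : (g x ≡ x ⊎ ¬ T (gMinᵇ x)) → ⊥
              contra (inj₁ fx) = d≢x (fixed-pre fx d k d<sM eq)
              contra (inj₂ nA) = nA (G.IsMin⇒isMinᵇ x Px)
                where
                  Px : G.IsMin x
                  Px k' with iter g k' x ≟ x
                  ... | yes e' = ≤-reflexive (sym e')
                  ... | no ne' = <⇒≤ (<-≤-trans x<d (subst (d ≤_) eq2 (R (k + k') ne'')))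
                    where
                      eq2 : iter g (k + k') d ≡ iter g k' x
                      eq2 = trans (iter-+ g k k' d) (cong (iter g k') eq)
                      ne'' : iter g (k + k') d ≢ x
                      ne'' e3 = ne' (trans (sym eq2) e3)

  gMinOffX : ℕ → Bool
  gMinOffX d = not (d ≡ᵇ x) ∧ gMinᵇ d
  hMinOffX : ℕ → Bool
  hMinOffX d = not (d ≡ᵇ x) ∧ hMinᵇ (squeeze d)

  gMinOffX≡hMinOffX : (g x ≡ x ⊎ ¬ T (gMinᵇ x)) → ∀ d → d < suc M → gMinOffX d ≡ hMinOffX d
  gMinOffX≡hMinOffX cond d d<sM with d ≟ x
  ... | yes refl rewrite ≡ᵇ-refl x = refl
  ... | no d≢x rewrite ≢⇒≡ᵇfalse d x d≢x = gMin≡hMin cond d d<sM d≢x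

  -- x is the minimum of its cycle and not fixed: the minimum d* of the h-cycle
  -- of squeeze (g x) is the one new cycle minimum
  module NewMinimum (gx≢x' : g x ≢ x) (tA : T (gMinᵇ x)) where
    y : ℕ
    y = g x
    y< : y < suc M
    y< = maps-g x x<sM
    ry< : squeeze y < M
    ry< = squeeze-bound x<sM y y< gx≢x'
    m : ℕ
    m = minOrb h M (squeeze y)
    i : ℕ
    i = proj₁ (minOrb-in h M (squeeze y))
    m≡ : m ≡ iter h i (squeeze y)
    m≡ = proj₂ (proj₂ (minOrb-in h M (squeeze y)))
    j' : ℕ
    j' = proj₁ (h-orbit⊆g-orbit y y< gx≢x' i)
    oeq : iter h i (squeeze y) ≡ squeeze (iter g j' y)
    oeq = proj₁ (proj₂ (h-orbit⊆g-orbit y y< gx≢x' i))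
    one : iter g j' y ≢ x
    one = proj₂ (proj₂ (h-orbit⊆g-orbit y y< gx≢x' i))
    d* : ℕ
    d* = iter g (suc j') x
    d*≢x : d* ≢ x
    d*≢x = one
    d*< : d* < suc M
    d*< = G.iter-maps (suc j') x x<sM
    rd* : squeeze d* ≡ m
    rd* = sym (trans m≡ oeq)
    Bd* : T (hMinᵇ (squeeze d*))
    Bd* = subst (λ z → T (hMinᵇ z)) (sym rd*) (H.minOrb-isMin (squeeze y) ry<)
    x<d* : x < d*
    x<d* = ≤∧≢⇒< (G.isMinᵇ⇒IsMin x x<sM tA (suc j')) (λ eq → d*≢x (sym eq))
    nAd* : ¬ T (gMinᵇ d*)
    nAd* t with G.back x (suc j') x<sM
    ... | k , eq = <-irrefl refl (<-≤-trans x<d* (subst (d* ≤_) eq (G.isMinᵇ⇒IsMin d* d*< t k)))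
    Rd* : MinAwayFromX d*
    Rd* = hMinᵇ⇒minAway d* d*< d*≢x Bd*

    -- any other point that is an h-minimum but not a g-minimum has x in its
    -- orbit below it, hence lies on the cycle of d* and equals d*
    others : ∀ d → d < suc M → d ≢ d* → gMinOffX d ≡ hMinOffX d
    others d d<sM d≢d* with d ≟ x
    ... | yes refl rewrite ≡ᵇ-refl x = refl
    ... | no d≢x rewrite ≢⇒≡ᵇfalse d x d≢x = T-ext (gMin⇒hMin d d<sM d≢x) back'
      where
        back' : T (hMinᵇ (squeeze d)) → T (gMinᵇ d)
        back' t with gMinᵇ d in ad
        ... | true = tt
        ... | false = ⊥-elim (d≢d* (≤-antisym d≤d* d*≤d))
          where
            R = hMinᵇ⇒minAway d d<sM d≢x t
            ii = proj₁ (G.notMin⇒smaller d (λ t' → subst T ad t'))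
            lt = proj₂ (G.notMin⇒smaller d (λ t' → subst T ad t'))
            itx : iter g ii d ≡ x
            itx with iter g ii d ≟ x
            ... | yes e' = e'
            ... | no ne = ⊥-elim (<-irrefl refl (<-≤-trans lt (R ii ne)))
            eqd* : iter g (ii + suc j') d ≡ d*
            eqd* = trans (iter-+ g ii (suc j') d) (cong (iter g (suc j')) itx)
            d≤d* : d ≤ d*
            d≤d* = subst (d ≤_) eqd* (R (ii + suc j') (λ e' → d*≢x (trans (sym eqd*) e')))
            kk = proj₁ (G.back d (ii + suc j') d<sM)
            keq : iter g kk d* ≡ d
            keq = trans (cong (iter g kk) (sym eqd*)) (proj₂ (G.back d (ii + suc j') d<sM))
            d*≤d : d* ≤ d
            d*≤d = subst (d* ≤_) keq (Rd* kk (λ e' → d≢x (trans (sym keq) e')))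

    gMinOffX-d* : gMinOffX d* ≡ false
    gMinOffX-d* rewrite ≢⇒≡ᵇfalse d* x d*≢x = ¬T⇒≡false nAd*
    hMinOffX-d* : hMinOffX d* ≡ true
    hMinOffX-d* rewrite ≢⇒≡ᵇfalse d* x d*≢x = T⇒≡true Bd*

    countEq : countBelow hMinOffX (suc M) ≡ suc (countBelow gMinOffX (suc M))
    countEq = countBelow-one gMinOffX hMinOffX (suc M) d* d*< gMinOffX-d* hMinOffX-d* others

  cycle-count : countCycles g (suc M) (suc M) ≡ countCycles h M M + (if g x ≡ᵇ x then 1 else 0)
  cycle-count = begin
    countCycles g (suc M) (suc M)
      ≡⟨ countCycles≡countBelow g (suc M) (suc M) ⟩
    countBelow gMinᵇ (suc M)
      ≡⟨ countBelow-split gMinᵇ ⟩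
    countBelow gMinOffX (suc M) + (if gMinᵇ x then 1 else 0)
      ≡⟨ x-contribution ⟩
    countBelow hMinOffX (suc M) + (if g x ≡ᵇ x then 1 else 0)
      ≡⟨ cong (_+ (if g x ≡ᵇ x then 1 else 0)) (sym (Reindex.reindex hMinᵇ)) ⟩
    countBelow hMinᵇ M + (if g x ≡ᵇ x then 1 else 0)
      ≡⟨ cong (_+ (if g x ≡ᵇ x then 1 else 0)) (sym (countCycles≡countBelow h M M)) ⟩
    countCycles h M M + (if g x ≡ᵇ x then 1 else 0) ∎
    where
      open ≡-Reasoning
      -- a minimum at x is lost unless x is fixed; then a new minimum d* appears
      x-contribution : countBelow gMinOffX (suc M) + (if gMinᵇ x then 1 else 0) ≡ countBelow hMinOffX (suc M) + (if g x ≡ᵇ x then 1 else 0)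
      x-contribution with g x ≡ᵇ x in gxb | gMinᵇ x in ax
      ... | true | true = cong (_+ 1) (countBelow-ext gMinOffX hMinOffX (suc M) (gMinOffX≡hMinOffX (inj₁ fx)))
        where fx = ≡ᵇ⇒≡ (g x) x (subst T (sym gxb) tt)
      ... | true | false = ⊥-elim (subst T ax (G.IsMin⇒isMinᵇ x (λ k → ≤-reflexive (sym (iter-fix fx k)))))
        where fx = ≡ᵇ⇒≡ (g x) x (subst T (sym gxb) tt)
      ... | false | false = cong (_+ 0) (countBelow-ext gMinOffX hMinOffX (suc M) (gMinOffX≡hMinOffX (inj₂ (λ t → subst T ax t))))
      ... | false | true = trans (+-comm _ 1) (sym (trans (+-identityʳ _) (NewMinimum.countEq nfx (subst T (sym ax) tt))))
        where nfx : g x ≢ x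
              nfx e' = subst T gxb (≡⇒≡ᵇ (g x) x e')

removal : ∀ g M x → x < suc M → Maps g (suc M) → Inj g (suc M) →
  (countCycles g (suc M) (suc M) ≡ countCycles (bypass g x) M M + (if g x ≡ᵇ x then 1 else 0)) ×
  Maps (bypass g x) M × Inj (bypass g x) M
removal g M x x<sM maps-g inj-g = cycle-count , maps-h , inj-h
  where open Removal g M x x<sM maps-g inj-g

at-++ˡ : ∀ u v i → i < length u → at (u ++ v) i ≡ at u i
at-++ˡ (x ∷ u) v zero _ = refl
at-++ˡ (x ∷ u) v (suc i) (s≤s lt) = at-++ˡ u v i lt

at-++ʳ : ∀ u v j → at (u ++ v) (length u + j) ≡ at v j
at-++ʳ [] v j = refl
at-++ʳ (x ∷ u) v j = at-++ʳ u v j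

div2e : ∀ i → (2 * i) / 2 ≡ i
div2e i = trans (/-congˡ (*-comm 2 i)) (m*n/n≡m i 2)

mod2e : ∀ i → (2 * i) % 2 ≡ 0
mod2e i = trans (cong (_% 2) (*-comm 2 i)) (m*n%n≡0 i 2)

div2o : ∀ i → suc (2 * i) / 2 ≡ i
div2o i = trans (/-congˡ {o = 2} (cong suc (*-comm 2 i)))
            (trans (+-distrib-/ 1 (i * 2) {2} (subst (λ z → 1 + z < 2) (sym (m*n%n≡0 i 2)) (s≤s (s≤s z≤n))))
                   (m*n/n≡m i 2))

mod2o : ∀ i → suc (2 * i) % 2 ≡ 1
mod2o i = trans (cong (λ z → suc z % 2) (*-comm 2 i)) ([m+kn]%n≡m%n 1 i 2)

sigma-e : ∀ w i → sigma w (2 * i) ≡ (if delta (at w i) then 2 * partner w i else suc (2 * partner w i))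
sigma-e w i rewrite div2e i | mod2e i = refl

sigma-o : ∀ w i → sigma w (suc (2 * i)) ≡ (if delta (at w i) then suc (2 * partner w i) else 2 * partner w i)
sigma-o w i rewrite div2o i | mod2o i = refl

alpha-e : ∀ k i → alpha k (2 * i) ≡ suc (2 * (suc i % suc k))
alpha-e k i rewrite mod2e i | div2e i = refl

alpha-o : ∀ k i → alpha k (suc (2 * i)) ≡ 2 * ((i + k) % suc k)
alpha-o k i rewrite mod2o i | div2o i = refl

nxt : ℕ → ℕ → ℕ
nxt k i = suc i % suc k

prv : ℕ → ℕ → ℕ
prv k i = (i + k) % suc k

nxt-lt : ∀ k i → suc i < suc k → nxt k i ≡ suc i
nxt-lt k i lt = m<n⇒m%n≡m lt

nxt-last : ∀ k → nxt k k ≡ 0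
nxt-last k = n%n≡0 (suc k)

prv-0 : ∀ k → prv k 0 ≡ k
prv-0 k = m<n⇒m%n≡m (n<1+n k)

prv-suc : ∀ k i → i < suc k → prv k (suc i) ≡ i
prv-suc k i lt = trans (cong (_% suc k) (sym (+-suc i k))) (trans ([m+n]%n≡m%n i (suc k)) (m<n⇒m%n≡m lt))

2suc : ∀ i → 2 * suc i ≡ suc (suc (2 * i))
2suc i = cong suc (+-suc i (1 * i))

data Par : ℕ → Set where
  ev : ∀ i → Par (2 * i)
  od : ∀ i → Par (suc (2 * i))

par : ∀ d → Par d
par zero = ev 0
par (suc d) with par d
... | ev i = od i
... | od i = subst Par (2suc i) (ev (suc i))

ev-bound : ∀ {i L} → 2 * i < 2 * L → i < L
ev-bound {i} {L} lt = *-cancelˡ-< 2 i L lt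

ev-bound' : ∀ {i L} → i < L → 2 * i < 2 * L
ev-bound' lt = *-monoʳ-< 2 lt

od-bound : ∀ {i L} → suc (2 * i) < 2 * L → i < L
od-bound lt = ev-bound (<-trans (n<1+n _) lt)

od-bound' : ∀ {i L} → i < L → suc (2 * i) < 2 * L
od-bound' {i} {L} lt = subst (_≤ 2 * L) (2suc i) (*-monoʳ-≤ 2 lt)

2*-inj : ∀ {i j} → 2 * i ≡ 2 * j → i ≡ j
2*-inj {i} {j} eq = *-cancelˡ-≡ i j 2 eq

ev≢od : ∀ i j → 2 * i ≢ suc (2 * j)
ev≢od i j eq = 0≢1+n (trans (sym (mod2e i)) (trans (cong (_% 2) eq) (mod2o j)))

findPartner-first : ∀ (w : Word) ℓ i j m → m < length w → label (at w m) ≡ ℓ → j + m ≢ i →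
           (∀ m' → m' < m → label (at w m') ≡ ℓ → j + m' ≡ i) →
           findPartner ℓ i j w ≡ just (j + m)
findPartner-first (x ∷ w) ℓ i j zero _ lab ne _
  rewrite lab | ≡ᵇ-refl ℓ | ≢⇒≡ᵇfalse j i (λ e → ne (trans (+-identityʳ j) e)) = cong just (sym (+-identityʳ j))
findPartner-first (x ∷ w) ℓ i j (suc m) (s≤s lt) lab ne frst with label x ≟ ℓ
... | yes lx rewrite T⇒≡true (≡⇒≡ᵇ _ _ lx) | T⇒≡true (≡⇒≡ᵇ j i (trans (sym (+-identityʳ j)) (frst 0 (s≤s z≤n) lx))) = trans (findPartner-first w ℓ i (suc j) m lt lab (λ e → ne (trans (+-suc j m) e))
                           (λ m' lt' l' → trans (sym (+-suc j m')) (frst (suc m') (s≤s lt') l')))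
                         (cong just (sym (+-suc j m)))
... | no lx rewrite ≢⇒≡ᵇfalse (label x) ℓ lx =
  trans (findPartner-first w ℓ i (suc j) m lt lab (λ e → ne (trans (+-suc j m) e))
          (λ m' lt' l' → trans (sym (+-suc j m')) (frst (suc m') (s≤s lt') l')))
        (cong just (sym (+-suc j m)))

partner-char : ∀ w i q → q < length w → label (at w q) ≡ label (at w i) → q ≢ i →
               (∀ m → m < q → label (at w m) ≡ label (at w i) → m ≡ i) → partner w i ≡ q
partner-char w i q q<L lab ne frst rewrite findPartner-first w (label (at w i)) i 0 q q<L lab ne frst = refl

Paired : Word → Set
Paired w = ∀ i → i < length w → Σ ℕ λ q → q < length w × q ≢ i × label (at w q) ≡ label (at w i) ×
          (∀ m → m < length w → label (at w m) ≡ label (at w i) → m ≡ i ⊎ m ≡ q)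

module PairedWord (w : Word) (two : Paired w) where
  partner-from : ∀ i q → i < length w → q < length w → q ≢ i → label (at w q) ≡ label (at w i) → partner w i ≡ q
  partner-from i q i<L q<L q≢i lab with two i i<L
  ... | q₀ , q₀<L , q₀≢i , lab₀ , uniq with uniq q q<L lab
  ... | inj₁ q≡i = ⊥-elim (q≢i q≡i)
  ... | inj₂ refl = partner-char w i q q<L lab q≢i frst
    where
      frst : ∀ m → m < q → label (at w m) ≡ label (at w i) → m ≡ i
      frst m m<q lm with uniq m (<-trans m<q q<L) lm
      ... | inj₁ e = e
      ... | inj₂ e = ⊥-elim (<-irrefl e m<q)

  pt : ∀ i → i < length w → Σ ℕ λ q → partner w i ≡ q × q < length w × q ≢ i × label (at w q) ≡ label (at w i)
  pt i i<L with two i i<L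
  ... | q , q<L , q≢i , lab , _ = q , partner-from i q i<L q<L q≢i lab , q<L , q≢i , lab

  partner-lt : ∀ i → i < length w → partner w i < length w
  partner-lt i i<L with pt i i<L
  ... | q , eq , q<L , _ = subst (_< length w) (sym eq) q<L

  partner-ne : ∀ i → i < length w → partner w i ≢ i
  partner-ne i i<L with pt i i<L
  ... | q , eq , _ , q≢i , _ = subst (_≢ i) (sym eq) q≢i

  partner-lab : ∀ i → i < length w → label (at w (partner w i)) ≡ label (at w i)
  partner-lab i i<L with pt i i<L
  ... | q , eq , _ , _ , lab = subst (λ z → label (at w z) ≡ label (at w i)) (sym eq) lab

  partner-invol : ∀ i → i < length w → partner w (partner w i) ≡ i
  partner-invol i i<L = partner-from (partner w i) i (partner-lt i i<L) i<L (λ e → partner-ne i i<L (sym e)) (sym (partner-lab i i<L))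

  partner-inj : ∀ i j → i < length w → j < length w → partner w i ≡ partner w j → i ≡ j
  partner-inj i j i<L j<L eq = trans (sym (partner-invol i i<L)) (trans (cong (partner w) eq) (partner-invol j j<L))

prv-nxt : ∀ k i → i < suc k → prv k (nxt k i) ≡ i
prv-nxt k i i<L with m≤n⇒m<n∨m≡n i<L
... | inj₁ si<L rewrite nxt-lt k i si<L = prv-suc k i (<-trans (n<1+n i) si<L)
... | inj₂ refl rewrite nxt-last k = prv-0 k

nxt-prv : ∀ k i → i < suc k → nxt k (prv k i) ≡ i
nxt-prv k zero _ rewrite prv-0 k = nxt-last k
nxt-prv k (suc i) si<L rewrite prv-suc k i (<-trans (n<1+n i) si<L) = nxt-lt k i si<L

nxt-bound : ∀ k i → nxt k i < suc k
nxt-bound k i = m%n<n (suc i) (suc k)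

prv-bound : ∀ k i → prv k i < suc k
prv-bound k i = m%n<n (i + k) (suc k)

alpha-maps : ∀ k d → d < 2 * suc k → alpha k d < 2 * suc k
alpha-maps k d d< with par d
... | ev i rewrite alpha-e k i = od-bound' (nxt-bound k i)
... | od i rewrite alpha-o k i = ev-bound' (prv-bound k i)

alpha-invol : ∀ k d → d < 2 * suc k → alpha k (alpha k d) ≡ d
alpha-invol k d d< with par d
... | ev i rewrite alpha-e k i | alpha-o k (nxt k i) = cong (2 *_) (prv-nxt k i (ev-bound d<))
... | od i rewrite alpha-o k i | alpha-e k (prv k i) = cong (λ z → suc (2 * z)) (nxt-prv k i (od-bound d<))

oo-inj : ∀ {a b} → suc (2 * a) ≡ suc (2 * b) → a ≡ b
oo-inj eq = 2*-inj (suc-injective eq)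

module FaceMap (w : Word) (k : ℕ) (len : length w ≡ suc k) (two : Paired w) where
  open PairedWord w two

  L : ℕ
  L = suc k

  p< : ∀ i → i < L → partner w i < L
  p< i i<L = subst (partner w i <_) len (partner-lt i (subst (i <_) (sym len) i<L))

  pinj : ∀ i j → i < L → j < L → partner w i ≡ partner w j → i ≡ j
  pinj i j i<L j<L = partner-inj i j (subst (i <_) (sym len) i<L) (subst (j <_) (sym len) j<L)

  sigma-maps : ∀ d → d < 2 * L → sigma w d < 2 * L
  sigma-maps d d< with par d
  ... | ev i rewrite sigma-e w i with delta (at w i)
  ... | true = ev-bound' (p< i (ev-bound d<))
  ... | false = od-bound' (p< i (ev-bound d<))
  sigma-maps d d< | od i rewrite sigma-o w i with delta (at w i)
  ... | true = od-bound' (p< i (od-bound d<))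
  ... | false = ev-bound' (p< i (od-bound d<))

  t≢f : true ≢ false
  t≢f ()

  sigma-inj : ∀ d₁ d₂ → d₁ < 2 * L → d₂ < 2 * L → sigma w d₁ ≡ sigma w d₂ → d₁ ≡ d₂
  sigma-inj d₁ d₂ l₁ l₂ eq with par d₁ | par d₂
  ... | ev i | ev j rewrite sigma-e w i | sigma-e w j with delta (at w i) | delta (at w j)
  ... | true | true = cong (2 *_) (pinj i j (ev-bound l₁) (ev-bound l₂) (2*-inj {partner w i} {partner w j} eq))
  ... | false | false = cong (2 *_) (pinj i j (ev-bound l₁) (ev-bound l₂) (oo-inj {partner w i} {partner w j} eq))
  ... | true | false = ⊥-elim (ev≢od (partner w i) (partner w j) eq)
  ... | false | true = ⊥-elim (ev≢od (partner w j) (partner w i) (sym eq))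
  sigma-inj d₁ d₂ l₁ l₂ eq | od i | od j rewrite sigma-o w i | sigma-o w j with delta (at w i) | delta (at w j)
  ... | true | true = cong (λ z → suc (2 * z)) (pinj i j (od-bound l₁) (od-bound l₂) (oo-inj {partner w i} {partner w j} eq))
  ... | false | false = cong (λ z → suc (2 * z)) (pinj i j (od-bound l₁) (od-bound l₂) (2*-inj {partner w i} {partner w j} eq))
  ... | true | false = ⊥-elim (ev≢od (partner w j) (partner w i) (sym eq))
  ... | false | true = ⊥-elim (ev≢od (partner w i) (partner w j) eq)
  sigma-inj d₁ d₂ l₁ l₂ eq | ev i | od j rewrite sigma-e w i | sigma-o w j with delta (at w i) in di | delta (at w j) in dj
  ... | true | true = ⊥-elim (ev≢od (partner w i) (partner w j) eq)
  ... | false | false = ⊥-elim (ev≢od (partner w j) (partner w i) (sym eq))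
  ... | true | false = ⊥-elim (t≢f (trans (sym di) (trans (cong (λ z → delta (at w z)) (pinj i j (ev-bound l₁) (od-bound l₂) (2*-inj {partner w i} {partner w j} eq))) dj)))
  ... | false | true = ⊥-elim (t≢f (trans (sym dj) (trans (cong (λ z → delta (at w z)) (sym (pinj i j (ev-bound l₁) (od-bound l₂) (oo-inj {partner w i} {partner w j} eq)))) di)))
  sigma-inj d₁ d₂ l₁ l₂ eq | od i | ev j rewrite sigma-o w i | sigma-e w j with delta (at w i) in di | delta (at w j) in dj
  ... | true | true = ⊥-elim (ev≢od (partner w j) (partner w i) (sym eq))
  ... | false | false = ⊥-elim (ev≢od (partner w i) (partner w j) eq)
  ... | true | false = ⊥-elim (t≢f (trans (sym di) (trans (cong (λ z → delta (at w z)) (pinj i j (od-bound l₁) (ev-bound l₂) (oo-inj {partner w i} {partner w j} eq))) dj)))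
  ... | false | true = ⊥-elim (t≢f (trans (sym dj) (trans (cong (λ z → delta (at w z)) (sym (pinj i j (od-bound l₁) (ev-bound l₂) (2*-inj {partner w i} {partner w j} eq)))) di)))

  φ : ℕ → ℕ
  φ d = sigma w (alpha k d)

  φ-maps : ∀ d → d < 2 * L → φ d < 2 * L
  φ-maps d d< = sigma-maps (alpha k d) (alpha-maps k d d<)

  φ-inj : ∀ d₁ d₂ → d₁ < 2 * L → d₂ < 2 * L → φ d₁ ≡ φ d₂ → d₁ ≡ d₂
  φ-inj d₁ d₂ l₁ l₂ eq = trans (sym (alpha-invol k d₁ l₁)) (trans (cong (alpha k) aeq) (alpha-invol k d₂ l₂))
    where aeq = sigma-inj _ _ (alpha-maps k d₁ l₁) (alpha-maps k d₂ l₂) eq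

open Renumber using (squeeze; stretch; squeeze-below; squeeze-above; stretch-below; stretch-above)

bypass-off : ∀ g x D v → g (stretch x D) ≡ v → v ≢ x → bypass g x D ≡ squeeze x v
bypass-off g x D v eq ne rewrite eq | ≢⇒≡ᵇfalse v x ne = refl

bypass-through : ∀ g x D → g (stretch x D) ≡ x → bypass g x D ≡ squeeze x (g x)
bypass-through g x D eq rewrite eq | ≡ᵇ-refl x = refl

lit< : ∀ j k {t : T (j <ᵇ k)} → j < k
lit< j k {t} = <ᵇ⇒< j k t

-- A permutation g of [0, k + N) obtained from a permutation φ of [0, N) by
-- inserting a block of k new points at position P: shift k renumbers the
-- old points around the block [P, P + k).  The new points are deleted from
-- the top of the block down (by bypass); Reduces g k c records that this
-- ends with φ and that c of the deleted points were fixed when deleted, so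
-- that g has exactly c more cycles than φ.
module Block (φ : ℕ → ℕ) (N P : ℕ) (P≤N : P ≤ N) where

  shift : ℕ → ℕ → ℕ
  shift k d = if d <ᵇ P then d else d + k

  shift-below : ∀ k d → d < P → shift k d ≡ d
  shift-below k d d<P rewrite <ᵇ-true d<P = refl

  shift-above : ∀ k d → P ≤ d → shift k d ≡ d + k
  shift-above k d P≤d rewrite <ᵇ-false P≤d = refl

  shift-0 : ∀ d → shift 0 d ≡ d
  shift-0 d with d <? P
  ... | yes d<P = shift-below 0 d d<P
  ... | no d≮P = trans (shift-above 0 d (≮⇒≥ d≮P)) (+-identityʳ d)

  shift-∉-block : ∀ k j d → j < k → shift k d ≢ P + j
  shift-∉-block k j d j<k with d <? P
  ... | yes d<P rewrite shift-below k d d<P = λ eq → <-irrefl eq (<-≤-trans d<P (m≤m+n P j))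
  ... | no d≮P rewrite shift-above k d (≮⇒≥ d≮P) = λ eq → <-irrefl (sym eq) (+-mono-≤-< (≮⇒≥ d≮P) j<k)

  stretch-shift : ∀ k d → stretch (P + k) (shift k d) ≡ shift (suc k) d
  stretch-shift k d with d <? P
  ... | yes d<P rewrite shift-below k d d<P | shift-below (suc k) d d<P =
        stretch-below (P + k) d (<-≤-trans d<P (m≤m+n P k))
  ... | no d≮P rewrite shift-above k d (≮⇒≥ d≮P) | shift-above (suc k) d (≮⇒≥ d≮P) =
        trans (stretch-above (P + k) (d + k) (+-monoˡ-≤ k (≮⇒≥ d≮P))) (sym (+-suc d k))

  squeeze-shift : ∀ k d → squeeze (P + k) (shift (suc k) d) ≡ shift k d
  squeeze-shift k d with d <? P
  ... | yes d<P rewrite shift-below k d d<P | shift-below (suc k) d d<P =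
        squeeze-below (P + k) d (<-≤-trans d<P (m≤m+n P k))
  ... | no d≮P rewrite shift-above k d (≮⇒≥ d≮P) | shift-above (suc k) d (≮⇒≥ d≮P) | +-suc d k =
        squeeze-above (P + k) (suc (d + k)) (s≤s (+-monoˡ-≤ k (≮⇒≥ d≮P)))

  stretch-block : ∀ k j → j < k → stretch (P + k) (P + j) ≡ P + j
  stretch-block k j j<k = stretch-below (P + k) (P + j) (+-monoʳ-< P j<k)

  squeeze-block : ∀ k j → j < k → squeeze (P + k) (P + j) ≡ P + j
  squeeze-block k j j<k = squeeze-below (P + k) (P + j) (+-monoʳ-< P j<k)

  block-≢ : ∀ i j → i ≢ j → P + i ≢ P + j
  block-≢ i j ne eq = ne (+-cancelˡ-≡ P i j eq)

  block< : ∀ k → P + k < suc (k + N)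
  block< k = s≤s (subst (P + k ≤_) (+-comm N k) (+-monoˡ-≤ k P≤N))

  bypass-shift-off : ∀ g k d v → g (shift (suc k) d) ≡ v → v ≢ P + k →
                     bypass g (P + k) (shift k d) ≡ squeeze (P + k) v
  bypass-shift-off g k d v eq ne = bypass-off g (P + k) (shift k d) v (trans (cong g (stretch-shift k d)) eq) ne

  bypass-shift-through : ∀ g k d → g (shift (suc k) d) ≡ P + k →
                         bypass g (P + k) (shift k d) ≡ squeeze (P + k) (g (P + k))
  bypass-shift-through g k d eq = bypass-through g (P + k) (shift k d) (trans (cong g (stretch-shift k d)) eq)

  bypass-block-off : ∀ g k j v → j < k → g (P + j) ≡ v → v ≢ P + k →
                     bypass g (P + k) (P + j) ≡ squeeze (P + k) v
  bypass-block-off g k j v j<k eq ne = bypass-off g (P + k) (P + j) v (trans (cong g (stretch-block k j j<k)) eq) ne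

  bypass-block-through : ∀ g k j → j < k → g (P + j) ≡ P + k →
                         bypass g (P + k) (P + j) ≡ squeeze (P + k) (g (P + k))
  bypass-block-through g k j j<k eq = bypass-through g (P + k) (P + j) (trans (cong g (stretch-block k j j<k)) eq)

  data Reduces : (ℕ → ℕ) → ℕ → ℕ → Set where
    done : ∀ {g} → (∀ d → d < N → g d ≡ φ d) → Reduces g 0 0
    step : ∀ {g k c b} → (g (P + k) ≡ᵇ P + k) ≡ b → Reduces (bypass g (P + k)) k c →
           Reduces g (suc k) (c + (if b then 1 else 0))

  reduces-count : ∀ {g k c} → Reduces g k c → Maps g (k + N) → Inj g (k + N) →
                  countCycles g (k + N) (k + N) ≡ countCycles φ N N + c
  reduces-count (done agree) mp _ =
    trans (countCycles-ext _ φ N mp agree N ≤-refl) (sym (+-identityʳ _))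
  reduces-count {g} {suc k} (step {c = c} {b} fixed r) mp inj
    with removal g (k + N) (P + k) (block< k) mp inj
  ... | count , mp' , inj' = begin
    countCycles g (suc k + N) (suc k + N)
      ≡⟨ count ⟩
    countCycles (bypass g (P + k)) (k + N) (k + N) + (if g (P + k) ≡ᵇ P + k then 1 else 0)
      ≡⟨ cong₂ (λ n b' → n + (if b' then 1 else 0)) (reduces-count r mp' inj') fixed ⟩
    countCycles φ N N + c + (if b then 1 else 0)
      ≡⟨ +-assoc (countCycles φ N N) c _ ⟩
    countCycles φ N N + (c + (if b then 1 else 0)) ∎
    where open ≡-Reasoning

  -- Inserting a kink: the darts a and a' of φ are redirected through the
  -- block and one block point becomes a fixed point.  Agrees g k: g is φ
  -- on all other old darts.
  module Kinked (a a' : ℕ) where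
    Agrees : (ℕ → ℕ) → ℕ → Set
    Agrees g k = ∀ d → d < N → d ≢ a → d ≢ a' → g (shift k d) ≡ shift k (φ d)

    agrees-step : ∀ g k → Agrees g (suc k) → Agrees (bypass g (P + k)) k
    agrees-step g k ag d d<N da da' =
      trans (bypass-shift-off g k d (shift (suc k) (φ d)) (ag d d<N da da') (shift-∉-block (suc k) k (φ d) ≤-refl))
            (squeeze-shift k (φ d))

    record Z (g : ℕ → ℕ) : Set where
      field
        agrees : Agrees g 0
        at-a : g (shift 0 a) ≡ shift 0 (φ a)
        at-a' : g (shift 0 a') ≡ shift 0 (φ a')

    Z-done : ∀ g → Z g → ∀ d → d < N → g d ≡ φ d
    Z-done g z d d<N with d ≟ a | d ≟ a'
    ... | yes refl | _ = trans (cong g (sym (shift-0 d))) (trans (Z.at-a z) (shift-0 _))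
    ... | no _ | yes refl = trans (cong g (sym (shift-0 d))) (trans (Z.at-a' z) (shift-0 _))
    ... | no da | no da' = trans (cong g (sym (shift-0 d))) (trans (Z.agrees z d d<N da da') (shift-0 _))

    -- Curl of the first kind:  a ↦ P+3 ↦ P+2 ↦ φ a,  a' ↦ P+1 ↦ φ a',  P+0 fixed.
    record S4 (g : ℕ → ℕ) : Set where
      field
        agrees : Agrees g 4
        at-a : g (shift 4 a) ≡ P + 3
        at-3 : g (P + 3) ≡ P + 2
        at-2 : g (P + 2) ≡ shift 4 (φ a)
        at-a' : g (shift 4 a') ≡ P + 1
        at-1 : g (P + 1) ≡ shift 4 (φ a')
        at-0 : g (P + 0) ≡ P + 0

    record S3 (g : ℕ → ℕ) : Set where
      field
        agrees : Agrees g 3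
        at-a : g (shift 3 a) ≡ P + 2
        at-2 : g (P + 2) ≡ shift 3 (φ a)
        at-a' : g (shift 3 a') ≡ P + 1
        at-1 : g (P + 1) ≡ shift 3 (φ a')
        at-0 : g (P + 0) ≡ P + 0

    record S2 (g : ℕ → ℕ) : Set where
      field
        agrees : Agrees g 2
        at-a : g (shift 2 a) ≡ shift 2 (φ a)
        at-a' : g (shift 2 a') ≡ P + 1
        at-1 : g (P + 1) ≡ shift 2 (φ a')
        at-0 : g (P + 0) ≡ P + 0

    record S1 (g : ℕ → ℕ) : Set where
      field
        agrees : Agrees g 1
        at-a : g (shift 1 a) ≡ shift 1 (φ a)
        at-a' : g (shift 1 a') ≡ shift 1 (φ a')
        at-0 : g (P + 0) ≡ P + 0

    reduces-S1 : ∀ g → S1 g → Reduces g 1 1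
    reduces-S1 g s = step (trans (cong (_≡ᵇ P + 0) at-0) (≡ᵇ-refl (P + 0))) (done (Z-done _ z))
      where
        open S1 s
        z : Z (bypass g (P + 0))
        z = record
          { agrees = agrees-step g 0 agrees
          ; at-a = trans (bypass-shift-off g 0 a _ at-a (shift-∉-block 1 0 (φ a) ≤-refl)) (squeeze-shift 0 (φ a))
          ; at-a' = trans (bypass-shift-off g 0 a' _ at-a' (shift-∉-block 1 0 (φ a') ≤-refl)) (squeeze-shift 0 (φ a'))
          }

    reduces-S2 : ∀ g → S2 g → Reduces g 2 1
    reduces-S2 g s = step (trans (cong (_≡ᵇ P + 1) at-1) (≢⇒≡ᵇfalse _ _ (shift-∉-block 2 1 (φ a') ≤-refl))) (reduces-S1 _ s₁)
      where
        open S2 s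
        s₁ : S1 (bypass g (P + 1))
        s₁ = record
          { agrees = agrees-step g 1 agrees
          ; at-a = trans (bypass-shift-off g 1 a _ at-a (shift-∉-block 2 1 (φ a) ≤-refl)) (squeeze-shift 1 (φ a))
          ; at-a' = trans (bypass-shift-through g 1 a' at-a') (trans (cong (squeeze (P + 1)) at-1) (squeeze-shift 1 (φ a')))
          ; at-0 = trans (bypass-block-off g 1 0 _ (lit< 0 1) at-0 (block-≢ 0 1 λ ())) (squeeze-block 1 0 (lit< 0 1))
          }

    reduces-S3 : ∀ g → S3 g → Reduces g 3 1
    reduces-S3 g s = step (trans (cong (_≡ᵇ P + 2) at-2) (≢⇒≡ᵇfalse _ _ (shift-∉-block 3 2 (φ a) ≤-refl))) (reduces-S2 _ s₂)
      where
        open S3 s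
        s₂ : S2 (bypass g (P + 2))
        s₂ = record
          { agrees = agrees-step g 2 agrees
          ; at-a = trans (bypass-shift-through g 2 a at-a) (trans (cong (squeeze (P + 2)) at-2) (squeeze-shift 2 (φ a)))
          ; at-a' = trans (bypass-shift-off g 2 a' _ at-a' (block-≢ 1 2 λ ())) (squeeze-block 2 1 (lit< 1 2))
          ; at-1 = trans (bypass-block-off g 2 1 _ (lit< 1 2) at-1 (shift-∉-block 3 2 (φ a') ≤-refl)) (squeeze-shift 2 (φ a'))
          ; at-0 = trans (bypass-block-off g 2 0 _ (lit< 0 2) at-0 (block-≢ 0 2 λ ())) (squeeze-block 2 0 (lit< 0 2))
          }

    reduces-S4 : ∀ g → S4 g → Reduces g 4 1
    reduces-S4 g s = step (trans (cong (_≡ᵇ P + 3) at-3) (≢⇒≡ᵇfalse _ _ (block-≢ 2 3 λ ()))) (reduces-S3 _ s₃)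
      where
        open S4 s
        s₃ : S3 (bypass g (P + 3))
        s₃ = record
          { agrees = agrees-step g 3 agrees
          ; at-a = trans (bypass-shift-through g 3 a at-a) (trans (cong (squeeze (P + 3)) at-3) (squeeze-block 3 2 (lit< 2 3)))
          ; at-2 = trans (bypass-block-off g 3 2 _ (lit< 2 3) at-2 (shift-∉-block 4 3 (φ a) ≤-refl)) (squeeze-shift 3 (φ a))
          ; at-a' = trans (bypass-shift-off g 3 a' _ at-a' (block-≢ 1 3 λ ())) (squeeze-block 3 1 (lit< 1 3))
          ; at-1 = trans (bypass-block-off g 3 1 _ (lit< 1 3) at-1 (shift-∉-block 4 3 (φ a') ≤-refl)) (squeeze-shift 3 (φ a'))
          ; at-0 = trans (bypass-block-off g 3 0 _ (lit< 0 3) at-0 (block-≢ 0 3 λ ())) (squeeze-block 3 0 (lit< 0 3))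
          }

    -- Curl of the second kind:  a ↦ P+2 ↦ φ a,  a' ↦ P+0 ↦ P+1 ↦ φ a',  P+3 fixed.
    record T4 (g : ℕ → ℕ) : Set where
      field
        agrees : Agrees g 4
        at-a : g (shift 4 a) ≡ P + 2
        at-2 : g (P + 2) ≡ shift 4 (φ a)
        at-a' : g (shift 4 a') ≡ P + 0
        at-0 : g (P + 0) ≡ P + 1
        at-1 : g (P + 1) ≡ shift 4 (φ a')
        at-3 : g (P + 3) ≡ P + 3

    record T3 (g : ℕ → ℕ) : Set where
      field
        agrees : Agrees g 3
        at-a : g (shift 3 a) ≡ P + 2
        at-2 : g (P + 2) ≡ shift 3 (φ a)
        at-a' : g (shift 3 a') ≡ P + 0
        at-0 : g (P + 0) ≡ P + 1
        at-1 : g (P + 1) ≡ shift 3 (φ a')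

    record T2 (g : ℕ → ℕ) : Set where
      field
        agrees : Agrees g 2
        at-a : g (shift 2 a) ≡ shift 2 (φ a)
        at-a' : g (shift 2 a') ≡ P + 0
        at-0 : g (P + 0) ≡ P + 1
        at-1 : g (P + 1) ≡ shift 2 (φ a')

    record T1 (g : ℕ → ℕ) : Set where
      field
        agrees : Agrees g 1
        at-a : g (shift 1 a) ≡ shift 1 (φ a)
        at-a' : g (shift 1 a') ≡ P + 0
        at-0 : g (P + 0) ≡ shift 1 (φ a')

    reduces-T1 : ∀ g → T1 g → Reduces g 1 0
    reduces-T1 g s = step (trans (cong (_≡ᵇ P + 0) at-0) (≢⇒≡ᵇfalse _ _ (shift-∉-block 1 0 (φ a') ≤-refl))) (done (Z-done _ z))
      where
        open T1 s
        z : Z (bypass g (P + 0))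
        z = record
          { agrees = agrees-step g 0 agrees
          ; at-a = trans (bypass-shift-off g 0 a _ at-a (shift-∉-block 1 0 (φ a) ≤-refl)) (squeeze-shift 0 (φ a))
          ; at-a' = trans (bypass-shift-through g 0 a' at-a') (trans (cong (squeeze (P + 0)) at-0) (squeeze-shift 0 (φ a')))
          }

    reduces-T2 : ∀ g → T2 g → Reduces g 2 0
    reduces-T2 g s = step (trans (cong (_≡ᵇ P + 1) at-1) (≢⇒≡ᵇfalse _ _ (shift-∉-block 2 1 (φ a') ≤-refl))) (reduces-T1 _ t₁)
      where
        open T2 s
        t₁ : T1 (bypass g (P + 1))
        t₁ = record
          { agrees = agrees-step g 1 agrees
          ; at-a = trans (bypass-shift-off g 1 a _ at-a (shift-∉-block 2 1 (φ a) ≤-refl)) (squeeze-shift 1 (φ a))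
          ; at-a' = trans (bypass-shift-off g 1 a' _ at-a' (block-≢ 0 1 λ ())) (squeeze-block 1 0 (lit< 0 1))
          ; at-0 = trans (bypass-block-through g 1 0 (lit< 0 1) at-0) (trans (cong (squeeze (P + 1)) at-1) (squeeze-shift 1 (φ a')))
          }

    reduces-T3 : ∀ g → T3 g → Reduces g 3 0
    reduces-T3 g s = step (trans (cong (_≡ᵇ P + 2) at-2) (≢⇒≡ᵇfalse _ _ (shift-∉-block 3 2 (φ a) ≤-refl))) (reduces-T2 _ t₂)
      where
        open T3 s
        t₂ : T2 (bypass g (P + 2))
        t₂ = record
          { agrees = agrees-step g 2 agrees
          ; at-a = trans (bypass-shift-through g 2 a at-a) (trans (cong (squeeze (P + 2)) at-2) (squeeze-shift 2 (φ a)))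
          ; at-a' = trans (bypass-shift-off g 2 a' _ at-a' (block-≢ 0 2 λ ())) (squeeze-block 2 0 (lit< 0 2))
          ; at-0 = trans (bypass-block-off g 2 0 _ (lit< 0 2) at-0 (block-≢ 1 2 λ ())) (squeeze-block 2 1 (lit< 1 2))
          ; at-1 = trans (bypass-block-off g 2 1 _ (lit< 1 2) at-1 (shift-∉-block 3 2 (φ a') ≤-refl)) (squeeze-shift 2 (φ a'))
          }

    reduces-T4 : ∀ g → T4 g → Reduces g 4 1
    reduces-T4 g s = step (trans (cong (_≡ᵇ P + 3) at-3) (≡ᵇ-refl (P + 3))) (reduces-T3 _ t₃)
      where
        open T4 s
        t₃ : T3 (bypass g (P + 3))
        t₃ = record
          { agrees = agrees-step g 3 agrees
          ; at-a = trans (bypass-shift-off g 3 a _ at-a (block-≢ 2 3 λ ())) (squeeze-block 3 2 (lit< 2 3))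
          ; at-2 = trans (bypass-block-off g 3 2 _ (lit< 2 3) at-2 (shift-∉-block 4 3 (φ a) ≤-refl)) (squeeze-shift 3 (φ a))
          ; at-a' = trans (bypass-shift-off g 3 a' _ at-a' (block-≢ 0 3 λ ())) (squeeze-block 3 0 (lit< 0 3))
          ; at-0 = trans (bypass-block-off g 3 0 _ (lit< 0 3) at-0 (block-≢ 1 3 λ ())) (squeeze-block 3 1 (lit< 1 3))
          ; at-1 = trans (bypass-block-off g 3 1 _ (lit< 1 3) at-1 (shift-∉-block 4 3 (φ a') ≤-refl)) (squeeze-shift 3 (φ a'))
          }

bump : ℕ → ℕ → ℕ
bump n i = if i <ᵇ n then i else suc (suc i)

bump-suc : ∀ n i → bump (suc n) (suc i) ≡ suc (bump n i)
bump-suc n i with i <ᵇ n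
... | true = refl
... | false = refl

bump-mono : ∀ n i j → i < j → bump n i < bump n j
bump-mono n i j i<j with i <? n | j <? n
... | yes i<n | yes j<n rewrite <ᵇ-true i<n | <ᵇ-true j<n = i<j
... | yes i<n | no j≮n rewrite <ᵇ-true i<n | <ᵇ-false (≮⇒≥ j≮n) = <-trans i<j (<-trans (n<1+n j) (n<1+n (suc j)))
... | no i≮n | yes j<n = ⊥-elim (i≮n (<-trans i<j j<n))
... | no i≮n | no j≮n rewrite <ᵇ-false (≮⇒≥ i≮n) | <ᵇ-false (≮⇒≥ j≮n) = s≤s (s≤s i<j)

bump-reflects-< : ∀ n i j → bump n i < bump n j → i < j
bump-reflects-< n i j lt with <-cmp i j
... | tri< a _ _ = a
... | tri≈ _ refl _ = ⊥-elim (<-irrefl refl lt)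
... | tri> _ _ c = ⊥-elim (<-asym lt (bump-mono n j i c))

module InsertKink (u v : Word) (c : ℕ) (b : Bool) (s s' : Status) where
  w : Word
  w = u ++ v
  K1 : Letter
  K1 = mkL c b s
  K2 : Letter
  K2 = mkL c (not b) s'
  w' : Word
  w' = u ++ K1 ∷ K2 ∷ v
  p : ℕ
  p = length u
  L : ℕ
  L = length w

  lenw : L ≡ p + length v
  lenw = length-++ u

  lenw' : length w' ≡ suc (suc L)
  lenw' = trans (length-++ u) (trans (+-suc p (suc (length v))) (cong suc (trans (+-suc p (length v)) (cong suc (sym lenw)))))

  ι : ℕ → ℕ
  ι = bump p

  ι-lt : ∀ i → i < p → ι i ≡ i
  ι-lt i i<p rewrite <ᵇ-true i<p = refl

  ι-ge : ∀ i → p ≤ i → ι i ≡ suc (suc i)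
  ι-ge i p≤i rewrite <ᵇ-false p≤i = refl

  p≤L : p ≤ L
  p≤L = subst (p ≤_) (sym lenw) (m≤m+n p (length v))

  at'-lt : ∀ i → i < p → at w' i ≡ at w i
  at'-lt i i<p = trans (at-++ˡ u _ i i<p) (sym (at-++ˡ u v i i<p))

  at'-ge : ∀ j → at w' (p + suc (suc j)) ≡ at w (p + j)
  at'-ge j = trans (at-++ʳ u _ (suc (suc j))) (sym (at-++ʳ u v j))

  at'-ι : ∀ i → at w' (ι i) ≡ at w i
  at'-ι i with i <? p
  ... | yes i<p rewrite ι-lt i i<p = at'-lt i i<p
  ... | no i≮p rewrite ι-ge i (≮⇒≥ i≮p) =
        trans (cong (at w') (trans (cong (λ z → suc (suc z)) (sym (m+[n∸m]≡n (≮⇒≥ i≮p))))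
                 (sym (trans (+-suc p (suc (i ∸ p))) (cong suc (+-suc p (i ∸ p)))))))
              (trans (at'-ge (i ∸ p)) (cong (at w) (m+[n∸m]≡n (≮⇒≥ i≮p))))

  at'-p : at w' p ≡ K1
  at'-p = trans (cong (at w') (sym (+-identityʳ p))) (at-++ʳ u _ 0)

  at'-sp : at w' (suc p) ≡ K2
  at'-sp = trans (cong (at w') (sym (trans (+-suc p 0) (cong suc (+-identityʳ p))))) (at-++ʳ u _ 1)

  ι-bound : ∀ i → i < L → ι i < suc (suc L)
  ι-bound i i<L with i <? p
  ... | yes i<p rewrite ι-lt i i<p = <-trans i<L (<-trans (n<1+n L) (n<1+n (suc L)))
  ... | no i≮p rewrite ι-ge i (≮⇒≥ i≮p) = s≤s (s≤s i<L)

  ι-inj : ∀ i j → ι i ≡ ι j → i ≡ j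
  ι-inj i j eq with <-cmp i j
  ... | tri< i<j _ _ = ⊥-elim (<-irrefl eq (bump-mono p i j i<j))
  ... | tri≈ _ i≡j _ = i≡j
  ... | tri> _ _ j<i = ⊥-elim (<-irrefl (sym eq) (bump-mono p j i j<i))

  view : ∀ i' → i' < suc (suc L) → (Σ ℕ λ i → i < L × ι i ≡ i') ⊎ (i' ≡ p ⊎ i' ≡ suc p)
  view i' i'< with i' <? p
  ... | yes i'<p = inj₁ (i' , <-≤-trans i'<p p≤L , ι-lt i' i'<p)
  ... | no i'≮p with m≤n⇒m<n∨m≡n (≮⇒≥ i'≮p)
  ... | inj₂ eq = inj₂ (inj₁ (sym eq))
  ... | inj₁ p<i' with m≤n⇒m<n∨m≡n p<i'
  ... | inj₂ eq = inj₂ (inj₂ (sym eq))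
  ... | inj₁ sp<i' with i' | sp<i' | i'<
  ... | suc (suc i) | s≤s (s≤s p≤i) | s≤s (s≤s i<L) = inj₁ (i , i<L , ι-ge i p≤i)

  module Partners (two : Paired w) (two' : Paired w') where
    lab-ι : ∀ i → label (at w' (ι i)) ≡ label (at w i)
    lab-ι i = cong label (at'-ι i)

    lab-p : label (at w' p) ≡ c
    lab-p = cong label at'-p

    lab-sp : label (at w' (suc p)) ≡ c
    lab-sp = cong label at'-sp

    toL' : ∀ {i} → i < suc (suc L) → i < length w'
    toL' = subst (_ <_) (sym lenw')

    open PairedWord w two renaming (partner-lt to plt; partner-ne to pne; partner-lab to plab)
    module T' = PairedWord w' two'

    partner'-ι : ∀ i → i < L → partner w' (ι i) ≡ ι (partner w i)
    partner'-ι i i<L = T'.partner-from (ι i) (ι (partner w i)) (toL' (ι-bound i i<L)) (toL' (ι-bound _ (plt i i<L)))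
                         (λ e → pne i i<L (ι-inj _ _ e)) (trans (lab-ι _) (trans (plab i i<L) (sym (lab-ι i))))

    partner'-p : partner w' p ≡ suc p
    partner'-p = T'.partner-from p (suc p) (toL' (<-trans (s≤s p≤L) (n<1+n (suc L)))) (toL' (s≤s (s≤s p≤L)))
                   (λ e → <-irrefl (sym e) (n<1+n p)) (trans lab-sp (sym lab-p))

    partner'-sp : partner w' (suc p) ≡ p
    partner'-sp = T'.partner-from (suc p) p (toL' (s≤s (s≤s p≤L))) (toL' (<-trans (s≤s p≤L) (n<1+n (suc L))))
                   (λ e → <-irrefl e (n<1+n p)) (trans lab-p (sym lab-sp))

    -- For a nonempty w (of length suc k) the face map of w' is that of w
    -- with a block of four darts inserted at 2p (S4 or T4 shape, by the
    -- curl direction b), so w' has exactly one face more than w.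
    module Faces (k : ℕ) (len : L ≡ suc k) where
      k' : ℕ
      k' = suc (suc k)
      L'≡ : length w' ≡ suc k'
      L'≡ = trans lenw' (cong (λ z → suc (suc z)) len)

      A : ℕ
      A = prv k p
      B : ℕ
      B = nxt k A

      p≤sk : p ≤ suc k
      p≤sk = subst (p ≤_) len p≤L

      A-0 : p ≡ 0 → A ≡ k
      A-0 eq rewrite eq = prv-0 k

      A-s : ∀ p₀ → p ≡ suc p₀ → A ≡ p₀
      A-s p₀ eq rewrite eq = prv-suc k p₀ (subst (_≤ suc k) eq p≤sk)

      iL : ∀ {i} → i < L → i < suc k
      iL = subst (_ <_) len

      nxt'-last : nxt k' k' ≡ 0
      nxt'-last = nxt-last k'

      nxt-ι : ∀ i → i < L → i ≢ A → nxt k' (ι i) ≡ ι (nxt k i)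
      nxt-ι i i<L i≢A with i <? p
      ... | yes i<p = lem p refl i<p
        where
          lem : ∀ pp → p ≡ pp → i < pp → nxt k' (ι i) ≡ ι (nxt k i)
          lem (suc p₀) eq (s≤s i≤p₀) with m≤n⇒m<n∨m≡n i≤p₀
          ... | inj₂ i≡p₀ = ⊥-elim (i≢A (trans i≡p₀ (sym (A-s p₀ eq))))
          ... | inj₁ i<p₀ rewrite ι-lt i i<p | nxt-lt k i (<-≤-trans (s≤s i<p₀) (subst (_≤ suc k) eq p≤sk))
                 | ι-lt (suc i) (subst (suc i <_) (sym eq) (s≤s i<p₀)) =
                 nxt-lt k' i (<-trans (<-≤-trans (s≤s i<p₀) (subst (_≤ suc k) eq p≤sk)) (<-trans (n<1+n (suc k)) (n<1+n (suc (suc k)))))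
      ... | no i≮p rewrite ι-ge i (≮⇒≥ i≮p) with m≤n⇒m<n∨m≡n (iL i<L)
      ... | inj₁ si<sk rewrite nxt-lt k i si<sk | ι-ge (suc i) (≤-trans (≮⇒≥ i≮p) (n≤1+n i)) = nxt-lt k' (suc (suc i)) (s≤s (s≤s si<sk))
      ... | inj₂ si≡sk with suc-injective si≡sk
      ... | refl rewrite nxt-last k with p ≟ 0
      ...   | yes p≡0 = ⊥-elim (i≢A (sym (A-0 p≡0)))
      ...   | no p≢0 rewrite ι-lt 0 (n≢0⇒n>0 p≢0) = nxt'-last

      nxt'-ιA : nxt k' (ι A) ≡ p
      nxt'-ιA with p ≟ 0
      ... | yes p≡0 rewrite A-0 p≡0 | ι-ge k (subst (_≤ k) (sym p≡0) z≤n) | p≡0 = nxt'-last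
      ... | no p≢0 = lem p refl p≢0
        where
          lem : ∀ pp → p ≡ pp → pp ≢ 0 → nxt k' (ι A) ≡ p
          lem zero _ ne = ⊥-elim (ne refl)
          lem (suc p₀) eq _ rewrite A-s p₀ eq | ι-lt p₀ (subst (p₀ <_) (sym eq) ≤-refl) | eq =
            nxt-lt k' p₀ (s≤s (≤-trans (subst (_≤ suc k) eq p≤sk) (n≤1+n (suc k))))

      nxt'-p : nxt k' p ≡ suc p
      nxt'-p = nxt-lt k' p (s≤s (s≤s p≤sk))

      B-lt : p < suc k → B ≡ p
      B-lt p<sk with p ≟ 0
      ... | yes p≡0 rewrite A-0 p≡0 | p≡0 = nxt-last k
      ... | no p≢0 = lem p refl p≢0
        where
          lem : ∀ pp → p ≡ pp → pp ≢ 0 → B ≡ p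
          lem zero _ ne = ⊥-elim (ne refl)
          lem (suc p₀) eq _ rewrite A-s p₀ eq | eq = nxt-lt k p₀ p<sk

      B-eq : p ≡ suc k → B ≡ 0
      B-eq eq rewrite A-s k eq = nxt-last k

      nxt'-sp : nxt k' (suc p) ≡ ι B
      nxt'-sp with m≤n⇒m<n∨m≡n p≤sk
      ... | inj₁ p<sk rewrite B-lt p<sk | ι-ge p ≤-refl = nxt-lt k' (suc p) (s≤s (s≤s p<sk))
      ... | inj₂ p≡sk rewrite B-eq p≡sk | ι-lt 0 (subst (0 <_) (sym p≡sk) (s≤s z≤n)) | p≡sk = nxt'-last

      A<L : A < suc k
      A<L = prv-bound k p

      B<L : B < suc k
      B<L = nxt-bound k A

      ιb : ∀ i → i < suc k → ι i < suc k'
      ιb i i< = subst (ι i <_) (cong (λ x → suc (suc x)) len) (ι-bound i (subst (i <_) (sym len) i<))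

      prv-ι : ∀ i → i < suc k → i ≢ B → prv k' (ι i) ≡ ι (prv k i)
      prv-ι i i< i≢B = trans (cong (prv k') (sym eq1)) (prv-nxt k' (ι j) (ιb (prv k i) (prv-bound k i)))
        where
          j = prv k i
          j≢A : j ≢ A
          j≢A e = i≢B (trans (sym (nxt-prv k i i<)) (cong (nxt k) e))
          eq1 : nxt k' (ι j) ≡ ι i
          eq1 = trans (nxt-ι j (subst (j <_) (sym len) (prv-bound k i)) j≢A) (cong ι (nxt-prv k i i<))

      prv'-ιB : prv k' (ι B) ≡ suc p
      prv'-ιB = trans (cong (prv k') (sym nxt'-sp)) (prv-nxt k' (suc p) (s≤s (s≤s p≤sk)))

      prv'-sp : prv k' (suc p) ≡ p
      prv'-sp = trans (cong (prv k') (sym nxt'-p)) (prv-nxt k' p (s≤s (≤-trans p≤sk (n≤1+n (suc k)))))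

      prv'-p : prv k' p ≡ ι A
      prv'-p = trans (cong (prv k') (sym nxt'-ιA)) (prv-nxt k' (ι A) (ιb A A<L))

      φw : ℕ → ℕ
      φw d = sigma w (alpha k d)
      φ' : ℕ → ℕ
      φ' d = sigma w' (alpha k' d)

      P≤N : 2 * p ≤ 2 * suc k
      P≤N = *-monoʳ-≤ 2 p≤sk

      module St = Block φw (2 * suc k) (2 * p) P≤N
      module KS = St.Kinked (2 * A) (suc (2 * B))

      4+ : ∀ n → n + 4 ≡ suc (suc (suc (suc n)))
      4+ n = +-comm n 4

      2ss : ∀ q → 2 * suc (suc q) ≡ suc (suc (suc (suc (2 * q))))
      2ss q = trans (2suc (suc q)) (cong (λ z → suc (suc z)) (2suc q))

      E-ev : ∀ q → St.shift 4 (2 * q) ≡ 2 * ι q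
      E-ev q with q <? p
      ... | yes q<p rewrite ι-lt q q<p = St.shift-below 4 (2 * q) (ev-bound' q<p)
      ... | no q≮p rewrite ι-ge q (≮⇒≥ q≮p) = trans (St.shift-above 4 (2 * q) (*-monoʳ-≤ 2 (≮⇒≥ q≮p))) (trans (4+ (2 * q)) (sym (2ss q)))

      E-od : ∀ q → St.shift 4 (suc (2 * q)) ≡ suc (2 * ι q)
      E-od q with q <? p
      ... | yes q<p rewrite ι-lt q q<p = St.shift-below 4 (suc (2 * q)) (od-bound' q<p)
      ... | no q≮p rewrite ι-ge q (≮⇒≥ q≮p) = trans (St.shift-above 4 (suc (2 * q)) (≤-trans (*-monoʳ-≤ 2 (≮⇒≥ q≮p)) (n≤1+n _)))
                                                  (trans (4+ (suc (2 * q))) (cong suc (sym (2ss q))))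

      yL : ∀ {y} → y < suc k → y < L
      yL = subst (_ <_) (sym len)

      σ'-ev : ∀ y → y < suc k → sigma w' (2 * ι y) ≡ St.shift 4 (sigma w (2 * y))
      σ'-ev y y< rewrite sigma-e w' (ι y) | sigma-e w y | partner'-ι y (yL y<) | at'-ι y with delta (at w y)
      ... | true = sym (E-ev (partner w y))
      ... | false = sym (E-od (partner w y))

      σ'-od : ∀ y → y < suc k → sigma w' (suc (2 * ι y)) ≡ St.shift 4 (sigma w (suc (2 * y)))
      σ'-od y y< rewrite sigma-o w' (ι y) | sigma-o w y | partner'-ι y (yL y<) | at'-ι y with delta (at w y)
      ... | true = sym (E-od (partner w y))
      ... | false = sym (E-ev (partner w y))

      gen : KS.Agrees φ' 4
      gen d d<N da db with par d
      ... | ev i = trans (cong φ' (E-ev i)) (trans (cong (sigma w') (alpha-e k' (ι i)))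
                     (trans (cong (λ z → sigma w' (suc (2 * z))) (nxt-ι i (yL i<) (λ e → da (cong (2 *_) e))))
                       (trans (σ'-od (nxt k i) (nxt-bound k i)) (cong (λ z → St.shift 4 (sigma w z)) (sym (alpha-e k i))))))
        where i< = ev-bound d<N
      ... | od i = trans (cong φ' (E-od i)) (trans (cong (sigma w') (alpha-o k' (ι i)))
                     (trans (cong (λ z → sigma w' (2 * z)) (prv-ι i i< (λ e → db (cong (λ z → suc (2 * z)) e))))
                       (trans (σ'-ev (prv k i) (prv-bound k i)) (cong (λ z → St.shift 4 (sigma w z)) (sym (alpha-o k i))))))
        where i< = od-bound d<N

      eA : φ' (St.shift 4 (2 * A)) ≡ (if b then suc (2 * suc p) else 2 * suc p)
      eA = trans (cong φ' (E-ev A)) (trans (cong (sigma w') (alpha-e k' (ι A)))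
             (trans (cong (λ z → sigma w' (suc (2 * z))) nxt'-ιA)
               (trans (sigma-o w' p) (cong₂ (λ x q → if delta x then suc (2 * q) else 2 * q) at'-p partner'-p))))

      e2 : φ' (2 * suc p) ≡ St.shift 4 (φw (2 * A))
      e2 = trans (cong (sigma w') (alpha-e k' (suc p)))
             (trans (cong (λ z → sigma w' (suc (2 * z))) nxt'-sp)
               (trans (σ'-od B B<L) (cong (λ z → St.shift 4 (sigma w z)) (sym (alpha-e k A)))))

      e3 : φ' (suc (2 * suc p)) ≡ (if b then 2 * suc p else suc (2 * suc p))
      e3 = trans (cong (sigma w') (alpha-o k' (suc p)))
             (trans (cong (λ z → sigma w' (2 * z)) prv'-sp)
               (trans (sigma-e w' p) (cong₂ (λ x q → if delta x then 2 * q else suc (2 * q)) at'-p partner'-p)))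

      eB : φ' (St.shift 4 (suc (2 * B))) ≡ (if not b then 2 * p else suc (2 * p))
      eB = trans (cong φ' (E-od B)) (trans (cong (sigma w') (alpha-o k' (ι B)))
             (trans (cong (λ z → sigma w' (2 * z)) prv'-ιB)
               (trans (sigma-e w' (suc p)) (cong₂ (λ x q → if delta x then 2 * q else suc (2 * q)) at'-sp partner'-sp))))

      e1 : φ' (suc (2 * p)) ≡ St.shift 4 (φw (suc (2 * B)))
      e1 = begin
        sigma w' (alpha k' (suc (2 * p)))   ≡⟨ cong (sigma w') (alpha-o k' p) ⟩
        sigma w' (2 * prv k' p)             ≡⟨ cong (λ z → sigma w' (2 * z)) prv'-p ⟩
        sigma w' (2 * ι A)                  ≡⟨ σ'-ev A A<L ⟩
        St.shift 4 (sigma w (2 * A))        ≡⟨ cong (λ z → St.shift 4 (sigma w (2 * z))) (sym (prv-nxt k A A<L)) ⟩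
        St.shift 4 (sigma w (2 * prv k B))  ≡⟨ cong (λ z → St.shift 4 (sigma w z)) (sym (alpha-o k B)) ⟩
        St.shift 4 (φw (suc (2 * B)))       ∎
        where open ≡-Reasoning

      e0 : φ' (2 * p) ≡ (if not b then suc (2 * p) else 2 * p)
      e0 = trans (cong (sigma w') (alpha-e k' p))
             (trans (cong (λ z → sigma w' (suc (2 * z))) nxt'-p)
               (trans (sigma-o w' (suc p)) (cong₂ (λ x q → if delta x then suc (2 * q) else 2 * q) at'-sp partner'-sp)))

      P3 : 2 * p + 3 ≡ suc (2 * suc p)
      P3 = trans (+-comm (2 * p) 3) (cong suc (sym (2suc p)))
      P2 : 2 * p + 2 ≡ 2 * suc p
      P2 = trans (+-comm (2 * p) 2) (sym (2suc p))
      P1 : 2 * p + 1 ≡ suc (2 * p)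
      P1 = +-comm (2 * p) 1
      P0 : 2 * p + 0 ≡ 2 * p
      P0 = +-identityʳ (2 * p)

      S4-true : b ≡ true → KS.S4 φ'
      S4-true refl = record
        { agrees = gen
        ; at-a = trans eA (sym P3)
        ; at-3 = trans (cong φ' P3) (trans e3 (sym P2))
        ; at-2 = trans (cong φ' P2) e2
        ; at-a' = trans eB (sym P1)
        ; at-1 = trans (cong φ' P1) e1
        ; at-0 = trans (cong φ' P0) (trans e0 (sym P0))
        }

      T4-false : b ≡ false → KS.T4 φ'
      T4-false refl = record
        { agrees = gen
        ; at-a = trans eA (sym P2)
        ; at-2 = trans (cong φ' P2) e2
        ; at-a' = trans eB (sym P0)
        ; at-0 = trans (cong φ' P0) (trans e0 (sym P1))
        ; at-1 = trans (cong φ' P1) e1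
        ; at-3 = trans (cong φ' P3) (trans e3 (sym P3))
        }

      module FM' = FaceMap w' k' L'≡ two'

      N4 : 2 * suc k' ≡ 4 + 2 * suc k
      N4 = trans (2ss (suc k)) refl

      mp4 : Maps φ' (4 + 2 * suc k)
      mp4 = subst (Maps φ') N4 FM'.φ-maps
      inj4 : Inj φ' (4 + 2 * suc k)
      inj4 = subst (Inj φ') N4 FM'.φ-inj

      countB : ∀ bb → b ≡ bb → countCycles φ' (4 + 2 * suc k) (4 + 2 * suc k) ≡ suc (countCycles φw (2 * suc k) (2 * suc k))
      countB true e = trans (St.reduces-count (KS.reduces-S4 φ' (S4-true e)) mp4 inj4) (+-comm _ 1)
      countB false e = trans (St.reduces-count (KS.reduces-T4 φ' (T4-false e)) mp4 inj4) (+-comm _ 1)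

      count : countCycles φ' (2 * suc k') (2 * suc k') ≡ suc (countCycles φw (2 * suc k) (2 * suc k))
      count = trans (cong (λ n → countCycles φ' n n) N4) (countB b refl)

faces-eq : ∀ w k → length w ≡ suc k → faces w ≡ countCycles (λ d → sigma w (alpha k d)) (2 * suc k) (2 * suc k)
faces-eq (x ∷ w) k eq rewrite suc-injective eq = refl

faces-eqF : ∀ w k → length w ≡ suc k → ∀ F → (∀ d → sigma w (alpha k d) ≡ F d) → faces w ≡ countCycles F (2 * suc k) (2 * suc k)
faces-eqF (x ∷ w) k eq F e rewrite suc-injective eq = countCycles-cong (λ d → sigma (x ∷ w) (alpha k d)) F e (2 * suc k) (2 * suc k)

planar-elim : ∀ w k → length w ≡ suc k → Planar w → 2 * faces w ≡ length w + 4
planar-elim (x ∷ w) k _ pl = pl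

planar-intro : ∀ w k → length w ≡ suc k → 2 * faces w ≡ length w + 4 → Planar w
planar-intro (x ∷ w) k _ pl = pl

-- The word consisting of one kink alone has three faces; Ft and Ff are its
-- face maps (for the two curl directions) written out explicitly.
Ft : ℕ → ℕ
Ft 0 = 0
Ft 1 = 1
Ft 2 = 3
Ft 3 = 2
Ft _ = 0

Ff : ℕ → ℕ
Ff 0 = 1
Ff 1 = 0
Ff 2 = 2
Ff 3 = 3
Ff _ = 0

Ft-maps : Maps Ft 4
Ft-maps 0 _ = s≤s z≤n
Ft-maps 1 _ = s≤s (s≤s z≤n)
Ft-maps 2 _ = s≤s (s≤s (s≤s (s≤s z≤n)))
Ft-maps 3 _ = s≤s (s≤s (s≤s z≤n))
Ft-maps (suc (suc (suc (suc d)))) (s≤s (s≤s (s≤s (s≤s ()))))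

Ff-maps : Maps Ff 4
Ff-maps 0 _ = s≤s (s≤s z≤n)
Ff-maps 1 _ = s≤s z≤n
Ff-maps 2 _ = s≤s (s≤s (s≤s z≤n))
Ff-maps 3 _ = s≤s (s≤s (s≤s (s≤s z≤n)))
Ff-maps (suc (suc (suc (suc d)))) (s≤s (s≤s (s≤s (s≤s ()))))

module KinkAlone (c : ℕ) (s s' : Status) where
  wt : Word
  wt = mkL c true s ∷ mkL c (not true) s' ∷ []
  wf : Word
  wf = mkL c false s ∷ mkL c (not false) s' ∷ []

  extt : ∀ d → d < 4 → Ft d ≡ sigma wt (alpha 1 d)
  extt 0 _ rewrite ≡ᵇ-refl c = refl
  extt 1 _ rewrite ≡ᵇ-refl c = refl
  extt 2 _ rewrite ≡ᵇ-refl c = refl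
  extt 3 _ rewrite ≡ᵇ-refl c = refl
  extt (suc (suc (suc (suc d)))) (s≤s (s≤s (s≤s (s≤s ()))))

  extf : ∀ d → d < 4 → Ff d ≡ sigma wf (alpha 1 d)
  extf 0 _ rewrite ≡ᵇ-refl c = refl
  extf 1 _ rewrite ≡ᵇ-refl c = refl
  extf 2 _ rewrite ≡ᵇ-refl c = refl
  extf 3 _ rewrite ≡ᵇ-refl c = refl
  extf (suc (suc (suc (suc d)))) (s≤s (s≤s (s≤s (s≤s ()))))

  ft : ℕ → ℕ
  ft d = sigma wt (alpha 1 d)
  ff : ℕ → ℕ
  ff d = sigma wf (alpha 1 d)

  et : countCycles Ft (2 * suc 1) (2 * suc 1) ≡ countCycles ft (2 * suc 1) (2 * suc 1)
  et = countCycles-ext Ft ft (2 * suc 1) Ft-maps extt (2 * suc 1) ≤-refl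

  ef : countCycles Ff (2 * suc 1) (2 * suc 1) ≡ countCycles ff (2 * suc 1) (2 * suc 1)
  ef = countCycles-ext Ff ff (2 * suc 1) Ff-maps extf (2 * suc 1) ≤-refl

  c3t : countCycles Ft (2 * suc 1) (2 * suc 1) ≡ 3
  c3t = refl
  c3f : countCycles Ff (2 * suc 1) (2 * suc 1) ≡ 3
  c3f = refl

  pt : Planar wt
  pt = cong (2 *_) (trans (faces-eq wt 1 refl) (trans (sym et) c3t))

  pf : Planar wf
  pf = cong (2 *_) (trans (faces-eq wf 1 refl) (trans (sym ef) c3f))

planar-nil : ∀ c b s s' → Planar (mkL c b s ∷ mkL c (not b) s' ∷ [])
planar-nil c true s s' = KinkAlone.pt c s s'
planar-nil c false s s' = KinkAlone.pf c s s'

++-nil : ∀ (u v : Word) → length (u ++ v) ≡ 0 → u ≡ [] × v ≡ []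
++-nil [] [] _ = refl , refl
++-nil [] (x ∷ v) ()
++-nil (x ∷ u) v ()

-- Inserting a kink into a planar word keeps it planar: by Euler's formula,
-- two more letters need exactly one more face.
planar-ins-k : ∀ u v c b s s' k → length (u ++ v) ≡ suc k → Paired (u ++ v) → Paired (u ++ mkL c b s ∷ mkL c (not b) s' ∷ v) →
             Planar (u ++ v) → Planar (u ++ mkL c b s ∷ mkL c (not b) s' ∷ v)
planar-ins-k u v c b s s' k leq two two' pl = planar-intro w' k' L'≡ eq
  where
    open InsertKink u v c b s s'
    open Partners two two'
    open Faces k leq
    c1 : faces w' ≡ countCycles φ' (2 * suc k') (2 * suc k')
    c1 = faces-eqF w' k' L'≡ φ' (λ d → refl)
    c4 : countCycles φw (2 * suc k) (2 * suc k) ≡ faces w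
    c4 = sym (faces-eqF w k leq φw (λ d → refl))
    fw : faces w' ≡ suc (faces w)
    fw = trans c1 (trans count (cong suc c4))
    eq : 2 * faces w' ≡ length w' + 4
    eq = trans (cong (2 *_) fw) (trans (2suc (faces w)) (trans (cong (λ z → suc (suc z)) (planar-elim w k leq pl))
           (cong (_+ 4) (sym lenw'))))

planar-ins-n : ∀ u v c b s s' n → length (u ++ v) ≡ n → Paired (u ++ v) → Paired (u ++ mkL c b s ∷ mkL c (not b) s' ∷ v) →
             Planar (u ++ v) → Planar (u ++ mkL c b s ∷ mkL c (not b) s' ∷ v)
planar-ins-n u v c b s s' zero leq two two' pl =
  subst₂ (λ a z → Planar (a ++ mkL c b s ∷ mkL c (not b) s' ∷ z)) (sym (proj₁ e)) (sym (proj₂ e)) (planar-nil c b s s')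
  where e = ++-nil u v leq
planar-ins-n u v c b s s' (suc k) leq two two' pl = planar-ins-k u v c b s s' k leq two two' pl

planar-ins : ∀ u v c b s s' → Paired (u ++ v) → Paired (u ++ mkL c b s ∷ mkL c (not b) s' ∷ v) →
             Planar (u ++ v) → Planar (u ++ mkL c b s ∷ mkL c (not b) s' ∷ v)
planar-ins u v c b s s' = planar-ins-n u v c b s s' (length (u ++ v)) refl

data Shape : Word → Word → Set where
  []ₛ : Shape [] []
  _∷ₛ_ : ∀ {x y w₁ w₂} → (label x ≡ label y × delta x ≡ delta y) → Shape w₁ w₂ → Shape (x ∷ w₁) (y ∷ w₂)

shape-refl : ∀ w → Shape w w
shape-refl [] = []ₛ
shape-refl (x ∷ w) = (refl , refl) ∷ₛ shape-refl w

shape-len : ∀ {w₁ w₂} → Shape w₁ w₂ → length w₁ ≡ length w₂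
shape-len []ₛ = refl
shape-len (_ ∷ₛ sh) = cong suc (shape-len sh)

shape-at : ∀ {w₁ w₂} → Shape w₁ w₂ → ∀ i → label (at w₁ i) ≡ label (at w₂ i) × delta (at w₁ i) ≡ delta (at w₂ i)
shape-at []ₛ i = refl , refl
shape-at (e ∷ₛ sh) zero = e
shape-at (e ∷ₛ sh) (suc i) = shape-at sh i

shape-fp : ∀ {w₁ w₂} → Shape w₁ w₂ → ∀ ℓ i j → findPartner ℓ i j w₁ ≡ findPartner ℓ i j w₂
shape-fp []ₛ ℓ i j = refl
shape-fp ((el , _) ∷ₛ sh) ℓ i j rewrite el | shape-fp sh ℓ i (suc j) = refl

shape-partner : ∀ {w₁ w₂} → Shape w₁ w₂ → ∀ i → partner w₁ i ≡ partner w₂ i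
shape-partner sh i rewrite proj₁ (shape-at sh i) = cong (fromMaybe i) (shape-fp sh _ i 0)

shape-sigma : ∀ {w₁ w₂} → Shape w₁ w₂ → ∀ d → sigma w₁ d ≡ sigma w₂ d
shape-sigma sh d rewrite shape-partner sh (d / 2) | proj₂ (shape-at sh (d / 2)) = refl

shape-faces : ∀ {w₁ w₂} → Shape w₁ w₂ → faces w₁ ≡ faces w₂
shape-faces []ₛ = refl
shape-faces {x ∷ w₁} {y ∷ w₂} sh@(_ ∷ₛ sh') = lem (length w₁) (length w₂) (shape-len sh')
  where
    lem : ∀ k₁ k₂ → k₁ ≡ k₂ → countCycles (λ d → sigma (x ∷ w₁) (alpha k₁ d)) (2 * suc k₁) (2 * suc k₁) ≡
                                countCycles (λ d → sigma (y ∷ w₂) (alpha k₂ d)) (2 * suc k₂) (2 * suc k₂)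
    lem k k refl = countCycles-cong (λ d → sigma (x ∷ w₁) (alpha k d)) (λ d → sigma (y ∷ w₂) (alpha k d))
                     (λ d → shape-sigma sh (alpha k d)) (2 * suc k) (2 * suc k)

shape-planar : ∀ {w₁ w₂} → Shape w₁ w₂ → Planar w₁ → Planar w₂
shape-planar []ₛ pl = pl
shape-planar {x ∷ w₁} {y ∷ w₂} sh@(_ ∷ₛ sh') pl rewrite sym (shape-faces sh) | shape-len sh' = pl

shape-trans : ∀ {w₁ w₂ w₃} → Shape w₁ w₂ → Shape w₂ w₃ → Shape w₁ w₃
shape-trans []ₛ []ₛ = []ₛ
shape-trans ((a , b) ∷ₛ s) ((a' , b') ∷ₛ s') = (trans a a' , trans b b') ∷ₛ shape-trans s s'

setSt : Word → ℕ → Status → Word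
setSt [] _ _ = []
setSt (x ∷ w) zero s = mkL (label x) (delta x) s ∷ w
setSt (x ∷ w) (suc i) s = x ∷ setSt w i s

len-setSt : ∀ w i s → length (setSt w i s) ≡ length w
len-setSt [] i s = refl
len-setSt (x ∷ w) zero s = refl
len-setSt (x ∷ w) (suc i) s = cong suc (len-setSt w i s)

at-setSt-eq : ∀ w i s → i < length w → at (setSt w i s) i ≡ mkL (label (at w i)) (delta (at w i)) s
at-setSt-eq (x ∷ w) zero s _ = refl
at-setSt-eq (x ∷ w) (suc i) s (s≤s lt) = at-setSt-eq w i s lt

at-setSt-ne : ∀ w i s j → j ≢ i → at (setSt w i s) j ≡ at w j
at-setSt-ne [] i s j _ = refl
at-setSt-ne (x ∷ w) zero s zero ne = ⊥-elim (ne refl)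
at-setSt-ne (x ∷ w) zero s (suc j) ne = refl
at-setSt-ne (x ∷ w) (suc i) s zero ne = refl
at-setSt-ne (x ∷ w) (suc i) s (suc j) ne = at-setSt-ne w i s j (λ e → ne (cong suc e))

lab-setSt : ∀ w i s j → label (at (setSt w i s) j) ≡ label (at w j)
lab-setSt [] i s j = refl
lab-setSt (x ∷ w) zero s zero = refl
lab-setSt (x ∷ w) zero s (suc j) = refl
lab-setSt (x ∷ w) (suc i) s zero = refl
lab-setSt (x ∷ w) (suc i) s (suc j) = lab-setSt w i s j

del-setSt : ∀ w i s j → delta (at (setSt w i s) j) ≡ delta (at w j)
del-setSt [] i s j = refl
del-setSt (x ∷ w) zero s zero = refl
del-setSt (x ∷ w) zero s (suc j) = refl
del-setSt (x ∷ w) (suc i) s zero = refl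
del-setSt (x ∷ w) (suc i) s (suc j) = del-setSt w i s j

setSt-++ : ∀ u r m s → setSt (u ++ r) (length u + m) s ≡ u ++ setSt r m s
setSt-++ [] r m s = refl
setSt-++ (x ∷ u) r m s = cong (x ∷_) (setSt-++ u r m s)

count-setSt : ∀ ℓ w i s → countLabel ℓ (setSt w i s) ≡ countLabel ℓ w
count-setSt ℓ [] i s = refl
count-setSt ℓ (x ∷ w) zero s = refl
count-setSt ℓ (x ∷ w) (suc i) s rewrite count-setSt ℓ w i s = refl

split1 : ∀ (w : Word) i → i < length w → Σ Word λ u → Σ Letter λ x → Σ Word λ r → w ≡ u ++ x ∷ r × length u ≡ i
split1 (x ∷ w) zero _ = [] , x , w , refl , refl
split1 (x ∷ w) (suc i) (s≤s lt) with split1 w i lt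
... | u , y , r , eq , len = x ∷ u , y , r , cong (x ∷_) eq , cong suc len

at-mid : ∀ u (x : Letter) r → at (u ++ x ∷ r) (length u) ≡ x
at-mid u x r = trans (cong (at (u ++ x ∷ r)) (sym (+-identityʳ (length u)))) (at-++ʳ u (x ∷ r) 0)

at-mid2 : ∀ u (x : Letter) v (y : Letter) t → at (u ++ x ∷ v ++ y ∷ t) (length u + suc (length v)) ≡ y
at-mid2 u x v y t = trans (at-++ʳ u (x ∷ v ++ y ∷ t) (suc (length v))) (at-mid v y t)

record Split2 (w : Word) (i j : ℕ) : Set where
  constructor mkS2
  field
    u v t : Word
    x y : Letter
    eq : w ≡ u ++ x ∷ v ++ y ∷ t
    li : length u ≡ i
    lj : length u + suc (length v) ≡ j

split2 : ∀ w i j → i < j → j < length w → Split2 w i j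
split2 w i j i<j j<L with split1 w i (<-trans i<j j<L)
... | u , x , r , refl , refl with split1 r (j ∸ suc (length u)) r<
  where
    r< : j ∸ suc (length u) < length r
    r< = +-cancelˡ-< (suc (length u)) _ _ (subst (_< suc (length u) + length r) (sym (m+[n∸m]≡n i<j))
           (subst (j <_) (trans (length-++ u) (+-suc (length u) (length r))) j<L))
... | v , y , t , refl , lv = mkS2 u v t x y refl refl
       (trans (+-suc (length u) (length v)) (trans (cong (suc (length u) +_) lv) (m+[n∸m]≡n i<j)))

j<L-lem : ∀ u (x : Letter) v (y : Letter) t → length u + suc (length v) < length (u ++ x ∷ v ++ y ∷ t)
j<L-lem u x v y t = subst (length u + suc (length v) <_) (sym (length-++ u))
            (+-monoʳ-< (length u) (s≤s (subst (length v <_) (sym (length-++ v)) (m<m+n (length v) (s≤s z≤n)))))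

record RIdx (w w' : Word) : Set where
  constructor mkRI
  field
    i j : ℕ
    s s' : Status
    i<j : i < j
    j<L : j < length w
    lab : label (at w i) ≡ label (at w j)
    sti : st (at w i) ≡ unres
    stj : st (at w j) ≡ unres
    coh : Coherent s s'
    sne : s ≢ unres
    weq : w' ≡ setSt (setSt w i s) j s'

resolve→idx : ∀ {w w'} → Resolve w w' → RIdx w w'
resolve→idx (res u v t x y s s' lab sx sy coh ne) =
  mkRI (length u) (length u + suc (length v)) s s' (m<m+n (length u) (s≤s z≤n)) j<L
       (trans (cong label (at-mid u x _)) (trans lab (sym (cong label (at-mid2 u x v y t)))))
       (trans (cong st (at-mid u x _)) sx) (trans (cong st (at-mid2 u x v y t)) sy) coh ne weq
  where
    j<L : length u + suc (length v) < length (u ++ x ∷ v ++ y ∷ t)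
    j<L = subst (length u + suc (length v) <_) (sym (length-++ u))
            (+-monoʳ-< (length u) (s≤s (subst (length v <_) (sym (length-++ v)) (m<m+n (length v) (s≤s z≤n)))))
    weq : u ++ mkL (label x) (delta x) s ∷ v ++ mkL (label y) (delta y) s' ∷ t ≡
          setSt (setSt (u ++ x ∷ v ++ y ∷ t) (length u) s) (length u + suc (length v)) s'
    weq = sym (trans (cong (λ z → setSt z (length u + suc (length v)) s')
                        (trans (cong (λ m → setSt (u ++ x ∷ v ++ y ∷ t) m s) (sym (+-identityʳ (length u))))
                               (setSt-++ u (x ∷ v ++ y ∷ t) 0 s)))
                (trans (setSt-++ u _ (suc (length v)) s')
                       (cong (λ z → u ++ mkL (label x) (delta x) s ∷ z)
                         (trans (cong (λ m → setSt (v ++ y ∷ t) m s') (sym (+-identityʳ (length v))))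
                                (setSt-++ v (y ∷ t) 0 s')))))

idx→resolve : ∀ w i j s s' → i < j → j < length w → label (at w i) ≡ label (at w j) →
              st (at w i) ≡ unres → st (at w j) ≡ unres → Coherent s s' → s ≢ unres →
              Resolve w (setSt (setSt w i s) j s')
idx→resolve w i j s s' i<j j<L lab si sj coh ne with split2 w i j i<j j<L
... | mkS2 u v t x y refl refl refl =
  subst (Resolve (u ++ x ∷ v ++ y ∷ t)) (RIdx.weq (resolve→idx r)) r
  where
    r = res u v t x y s s' (trans (sym (cong label (at-mid u x _))) (trans lab (cong label (at-mid2 u x v y t))))
          (trans (sym (cong st (at-mid u x _))) si) (trans (sym (cong st (at-mid2 u x v y t))) sj) coh ne

[_]ᵇ : Bool → ℕ
[ b ]ᵇ = if b then 1 else 0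

countBelow-shift : ∀ (b : ℕ → Bool) n → countBelow b (suc n) ≡ [ b 0 ]ᵇ + countBelow (λ m → b (suc m)) n
countBelow-shift b zero with b 0
... | true = refl
... | false = refl
countBelow-shift b (suc n) with b (suc n) | countBelow-shift b n
... | true | ih = trans (cong suc ih) (sym (+-suc [ b 0 ]ᵇ _))
... | false | ih = ih

countLabel-countBelow : ∀ ℓ w → countLabel ℓ w ≡ countBelow (λ m → label (at w m) ≡ᵇ ℓ) (length w)
countLabel-countBelow ℓ [] = refl
countLabel-countBelow ℓ (x ∷ w) = trans lem (sym (countBelow-shift (λ m → label (at (x ∷ w) m) ≡ᵇ ℓ) (length w)))
  where
    lem : countLabel ℓ (x ∷ w) ≡ [ label x ≡ᵇ ℓ ]ᵇ + countBelow (λ m → label (at w m) ≡ᵇ ℓ) (length w)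
    lem with label x ≡ᵇ ℓ
    ... | true = cong suc (countLabel-countBelow ℓ w)
    ... | false = countLabel-countBelow ℓ w

countBelow-zero : ∀ (b : ℕ → Bool) n → countBelow b n ≡ 0 → ∀ m → m < n → b m ≡ false
countBelow-zero b (suc n) eq m m< with b n in bn
... | true = ⊥-elim (1+n≢0 eq)
... | false with m ≟ n
...   | yes refl = bn
...   | no m≢n = countBelow-zero b n eq m (≤∧≢⇒< (≤-pred m<) m≢n)

countBelow-pos : ∀ (b : ℕ → Bool) n c → countBelow b n ≡ suc c → Σ ℕ λ q → q < n × b q ≡ true
countBelow-pos b zero c ()
countBelow-pos b (suc n) c eq with b n in bn
... | true = n , ≤-refl , bn
... | false with countBelow-pos b n c eq
...   | q , q< , bq = q , m<n⇒m<1+n q< , bq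

except : (ℕ → Bool) → ℕ → ℕ → Bool
except b i m = if m ≡ᵇ i then false else b m

except-i : ∀ b i → except b i i ≡ false
except-i b i rewrite ≡ᵇ-refl i = refl

except-ne : ∀ b i m → m ≢ i → except b i m ≡ b m
except-ne b i m ne rewrite ≢⇒≡ᵇfalse m i ne = refl

countBelow-except : ∀ b n i → i < n → b i ≡ true → countBelow b n ≡ suc (countBelow (except b i) n)
countBelow-except b n i i<n bi = countBelow-one (except b i) b n i i<n (except-i b i) bi (λ d _ ne → except-ne b i d ne)

twice-partner : ∀ (b : ℕ → Bool) n i → countBelow b n ≡ 2 → i < n → b i ≡ true →
            Σ ℕ λ q → q < n × q ≢ i × b q ≡ true × (∀ m → m < n → b m ≡ true → m ≡ i ⊎ m ≡ q)
twice-partner b n i c2 i<n bi = q , q<n , q≢i , bq , uniq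
  where
    b' = except b i
    c1 : countBelow b' n ≡ 1
    c1 = suc-injective (trans (sym (countBelow-except b n i i<n bi)) c2)
    qq = countBelow-pos b' n 0 c1
    q = proj₁ qq
    q<n = proj₁ (proj₂ qq)
    b'q = proj₂ (proj₂ qq)
    q≢i : q ≢ i
    q≢i e = 0≢true (trans (sym (except-i b i)) (trans (cong (except b i) (sym e)) b'q))
      where
        0≢true : false ≢ true
        0≢true ()
    bq : b q ≡ true
    bq = trans (sym (except-ne b i q q≢i)) b'q
    c0 : countBelow (except b' q) n ≡ 0
    c0 = suc-injective (trans (sym (countBelow-except b' n q q<n b'q)) c1)
    uniq : ∀ m → m < n → b m ≡ true → m ≡ i ⊎ m ≡ q
    uniq m m< bm with m ≟ i | m ≟ q
    ... | yes e | _ = inj₁ e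
    ... | no _ | yes e = inj₂ e
    ... | no mi | no mq = ⊥-elim (f≢t (trans (sym (countBelow-zero (except b' q) n c0 m m<))
                                          (trans (except-ne b' q m mq) (trans (except-ne b i m mi) bm))))
      where
        f≢t : false ≢ true
        f≢t ()

TwiceI : Word → Set
TwiceI w = ∀ i → i < length w → countLabel (label (at w i)) w ≡ 2

CompatI : Word → Set
CompatI w = ∀ i j → i < j → j < length w → label (at w i) ≡ label (at w j) →
            (delta (at w i) ≢ delta (at w j)) × Coherent (st (at w i)) (st (at w j))

WFI : Word → Set
WFI w = TwiceI w × CompatI w

all-at : ∀ {P : Letter → Set} {w} → All P w → ∀ i → i < length w → P (at w i)
all-at (px ∷ _) zero _ = px
all-at (_ ∷ pw) (suc i) (s≤s lt) = all-at pw i lt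

at-all : ∀ {P : Letter → Set} w → (∀ i → i < length w → P (at w i)) → All P w
at-all [] h = []
at-all (x ∷ w) h = h 0 (s≤s z≤n) ∷ at-all w (λ i lt → h (suc i) (s≤s lt))

twiceI→two : ∀ w → TwiceI w → Paired w
twiceI→two w tw i i<L with twice-partner (λ m → label (at w m) ≡ᵇ label (at w i)) (length w) i
                              (trans (sym (countLabel-countBelow _ w)) (tw i i<L)) i<L (≡ᵇ-refl (label (at w i)))
... | q , q< , q≢i , bq , uniq = q , q< , q≢i , ≡ᵇ⇒≡ _ _ (subst T (sym bq) tt) ,
      λ m m< lm → uniq m m< (trans (cong (_≡ᵇ label (at w i)) lm) (≡ᵇ-refl (label (at w i))))

WF→WFI : ∀ w → WellFormed w → WFI w
WF→WFI w wf = (λ i i< → all-at (WellFormed.twice wf) i i<) , compatI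
  where
    compatI : CompatI w
    compatI i j i<j j<L lab with split2 w i j i<j j<L
    ... | mkS2 u v t x y refl refl refl =
      subst₂ (λ a b → (delta a ≢ delta b) × Coherent (st a) (st b)) (sym (at-mid u x _)) (sym (at-mid2 u x v y t))
        (WellFormed.compat wf u v t x y refl (trans (sym (cong label (at-mid u x _))) (trans lab (cong label (at-mid2 u x v y t)))))

WFI→WF : ∀ w → WFI w → WellFormed w
WFI→WF w (tw , ci) = record { twice = at-all w tw ; compat = compat }
  where
    compat : ∀ u v t x y → w ≡ u ++ x ∷ v ++ y ∷ t → label x ≡ label y → (delta x ≢ delta y) × Coherent (st x) (st y)
    compat u v t x y refl lab =
      subst₂ (λ a b → (delta a ≢ delta b) × Coherent (st a) (st b)) (at-mid u x _) (at-mid2 u x v y t)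
        (ci (length u) (length u + suc (length v)) (m<m+n (length u) (s≤s z≤n)) (j<L-lem u x v y t)
          (trans (cong label (at-mid u x _)) (trans lab (sym (cong label (at-mid2 u x v y t))))))

module ResolveWF (w : Word) (wfi : WFI w) (i₀ j₀ : ℕ) (s s' : Status) (i<j : i₀ < j₀) (j<L : j₀ < length w)
             (lab : label (at w i₀) ≡ label (at w j₀)) (coh : Coherent s s') where
  w' : Word
  w' = setSt (setSt w i₀ s) j₀ s'
  two : Paired w
  two = twiceI→two w (proj₁ wfi)
  i<L : i₀ < length w
  i<L = <-trans i<j j<L
  j≢i : j₀ ≢ i₀
  j≢i e = <-irrefl (sym e) i<j

  posOf : ∀ m → m < length w → label (at w m) ≡ label (at w i₀) → m ≡ i₀ ⊎ m ≡ j₀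
  posOf m m< lm with two i₀ i<L
  ... | q , q< , q≢i , lq , uniq with uniq j₀ j<L (sym lab)
  ... | inj₁ e = ⊥-elim (j≢i e)
  ... | inj₂ refl = uniq m m< lm

  not-crossing : ∀ {m} → m ≢ i₀ → m ≢ j₀ → ¬ (m ≡ i₀ ⊎ m ≡ j₀)
  not-crossing m≢i₀ _ (inj₁ e) = m≢i₀ e
  not-crossing _ m≢j₀ (inj₂ e) = m≢j₀ e

  lab' : ∀ m → label (at w' m) ≡ label (at w m)
  lab' m = trans (lab-setSt (setSt w i₀ s) j₀ s' m) (lab-setSt w i₀ s m)
  del' : ∀ m → delta (at w' m) ≡ delta (at w m)
  del' m = trans (del-setSt (setSt w i₀ s) j₀ s' m) (del-setSt w i₀ s m)
  len' : length w' ≡ length w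
  len' = trans (len-setSt (setSt w i₀ s) j₀ s') (len-setSt w i₀ s)
  at-other : ∀ m → m ≢ i₀ → m ≢ j₀ → at w' m ≡ at w m
  at-other m mi mj = trans (at-setSt-ne (setSt w i₀ s) j₀ s' m mj) (at-setSt-ne w i₀ s m mi)
  st-i : st (at w' i₀) ≡ s
  st-i = trans (cong st (at-setSt-ne (setSt w i₀ s) j₀ s' i₀ (λ e → j≢i (sym e)))) (cong st (at-setSt-eq w i₀ s i<L))
  st-j : st (at w' j₀) ≡ s'
  st-j = cong st (at-setSt-eq (setSt w i₀ s) j₀ s' (subst (j₀ <_) (sym (len-setSt w i₀ s)) j<L))

  twice' : TwiceI w'
  twice' m m< = trans (cong (λ ℓ → countLabel ℓ w') (lab' m))
                  (trans (count-setSt _ (setSt w i₀ s) j₀ s') (trans (count-setSt _ w i₀ s)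
                    (proj₁ wfi m (subst (m <_) len' m<))))

  compat' : CompatI w'
  compat' i j i<j' j< labeq with proj₂ wfi i j i<j' (subst (j <_) len' j<)
                                   (trans (sym (lab' i)) (trans labeq (lab' j)))
  ... | dne , ch = dne' , ch'
    where
      j<w : j < length w
      j<w = subst (j <_) len' j<
      i<w : i < length w
      i<w = <-trans i<j' j<w
      dne' : delta (at w' i) ≢ delta (at w' j)
      dne' e = dne (trans (sym (del' i)) (trans e (del' j)))
      labij : label (at w i) ≡ label (at w j)
      labij = trans (sym (lab' i)) (trans labeq (lab' j))
      ch' : Coherent (st (at w' i)) (st (at w' j))
      ch' with i ≟ i₀
      ... | yes refl with posOf j j<w (sym labij)
      ...   | inj₁ e = ⊥-elim (<-irrefl (sym e) i<j')
      ...   | inj₂ refl = subst₂ Coherent (sym st-i) (sym st-j) coh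
      ch' | no i≢i₀ with i ≟ j₀
      ... | yes refl with posOf j j<w (trans (sym labij) (sym lab))
      ...   | inj₁ e = ⊥-elim (<-irrefl (sym e) (<-trans i<j i<j'))
      ...   | inj₂ e = ⊥-elim (<-irrefl (sym e) i<j')
      ch' | no i≢i₀ | no i≢j₀ with j ≟ i₀ | j ≟ j₀
      ... | yes refl | _ = ⊥-elim (not-crossing i≢i₀ i≢j₀ (posOf i i<w labij))
      ... | no _ | yes refl = ⊥-elim (not-crossing i≢i₀ i≢j₀ (posOf i i<w (trans labij (sym lab))))
      ... | no j≢i₀ | no j≢j₀ = subst₂ Coherent (cong st (sym (at-other i i≢i₀ i≢j₀))) (cong st (sym (at-other j j≢i₀ j≢j₀))) ch

  wfi' : WFI w'
  wfi' = twice' , compat'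

resolve-WFI : ∀ {w w'} → WFI w → Resolve w w' → WFI w'
resolve-WFI {w} wfi r with resolve→idx r
... | mkRI i j s s' i<j j<L lab _ _ coh _ refl = ResolveWF.wfi' w wfi i j s s' i<j j<L lab coh

countLabel-++ : ∀ ℓ u r → countLabel ℓ (u ++ r) ≡ countLabel ℓ u + countLabel ℓ r
countLabel-++ ℓ [] r = refl
countLabel-++ ℓ (x ∷ u) r with label x ≡ᵇ ℓ
... | true = cong suc (countLabel-++ ℓ u r)
... | false = countLabel-++ ℓ u r

fresh-at : ∀ c w → countLabel c w ≡ 0 → ∀ i → i < length w → label (at w i) ≢ c
fresh-at c w z i i< e = t≢f (trans (sym (trans (cong (_≡ᵇ c) e) (≡ᵇ-refl c)))
                          (countBelow-zero (λ m → label (at w m) ≡ᵇ c) (length w) (trans (sym (countLabel-countBelow c w)) z) i i<))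
  where
    t≢f : true ≢ false
    t≢f ()

setSt-ins : ∀ u v (Ka Kb : Letter) i t → Σ Word λ u₁ → Σ Word λ v₁ → length u₁ ≡ length u ×
            setSt (u ++ v) i t ≡ u₁ ++ v₁ × setSt (u ++ Ka ∷ Kb ∷ v) (bump (length u) i) t ≡ u₁ ++ Ka ∷ Kb ∷ v₁
setSt-ins [] v Ka Kb i t = [] , setSt v i t , refl , refl , refl
setSt-ins (x ∷ u) v Ka Kb zero t = mkL (label x) (delta x) t ∷ u , v , refl , refl , refl
setSt-ins (x ∷ u) v Ka Kb (suc i) t with setSt-ins u v Ka Kb i t
... | u₁ , v₁ , l , e , e' = x ∷ u₁ , v₁ , cong suc l , cong (x ∷_) e ,
      trans (cong (λ z → setSt (x ∷ u ++ Ka ∷ Kb ∷ v) z t) (bump-suc (length u) i)) (cong (x ∷_) e')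

record InsRel (c : ℕ) (b : Bool) (s s' : Status) (q q' : Word) : Set where
  constructor mkIR
  field
    u v : Word
    qeq : q ≡ u ++ v
    q'eq : q' ≡ u ++ mkL c b s ∷ mkL c (not b) s' ∷ v
    fresh : countLabel c q ≡ 0

module InsertWF (u v : Word) (c : ℕ) (b : Bool) (s s' : Status) (wfi : WFI (u ++ v))
             (fr : countLabel c (u ++ v) ≡ 0) (coh : Coherent s s') where
  open InsertKink u v c b s s'
  freshI : ∀ i → i < L → label (at w i) ≢ c
  freshI = fresh-at c w fr
  len'< : ∀ {i} → i < length w' → i < suc (suc L)
  len'< = subst (_ <_) lenw'

  count-kink : ∀ ℓ → countLabel ℓ (K1 ∷ K2 ∷ v) ≡ (if c ≡ᵇ ℓ then suc (suc (countLabel ℓ v)) else countLabel ℓ v)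
  count-kink ℓ with c ≡ᵇ ℓ
  ... | true = refl
  ... | false = refl

  kink-label-twice : countLabel c w' ≡ 2
  kink-label-twice = trans (countLabel-++ c u _) (trans (cong (countLabel c u +_) (trans (count-kink c) (cong (λ z → if z then suc (suc (countLabel c v)) else countLabel c v) (≡ᵇ-refl c))))
         (trans (+-suc _ _) (cong suc (trans (+-suc _ _) (cong suc (trans (sym (countLabel-++ c u v)) fr))))))

  twice' : TwiceI w'
  twice' i' i'< with view i' (len'< i'<)
  ... | inj₁ (i , i<L , refl) = trans (cong (λ ℓ → countLabel ℓ w') (cong label (at'-ι i)))
          (trans (countLabel-++ _ u _) (trans (cong (countLabel ℓ u +_) (trans (count-kink ℓ) (cong (λ z → if z then suc (suc (countLabel ℓ v)) else countLabel ℓ v) (≢⇒≡ᵇfalse c ℓ (λ e → freshI i i<L (sym e))))))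
            (trans (sym (countLabel-++ ℓ u v)) (proj₁ wfi i i<L))))
    where ℓ = label (at w i)
  ... | inj₂ (inj₁ refl) = trans (cong (λ ℓ → countLabel ℓ w') (cong label at'-p)) kink-label-twice
  ... | inj₂ (inj₂ refl) = trans (cong (λ ℓ → countLabel ℓ w') (cong label at'-sp)) kink-label-twice

  ≢not : ∀ x → x ≢ not x
  ≢not true ()
  ≢not false ()

  compat' : CompatI w'
  compat' i' j' i'<j' j'< lb with view i' (len'< (<-trans i'<j' j'<)) | view j' (len'< j'<)
  ... | inj₁ (i , i<L , refl) | inj₁ (j , j<L , refl) =
        subst₂ (λ a b → (delta a ≢ delta b) × Coherent (st a) (st b)) (sym (at'-ι i)) (sym (at'-ι j))
          (proj₂ wfi i j (bump-reflects-< p i j i'<j') j<L (trans (sym (cong label (at'-ι i))) (trans lb (cong label (at'-ι j)))))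
  ... | inj₁ (i , i<L , refl) | inj₂ (inj₁ refl) = ⊥-elim (freshI i i<L (trans (sym (cong label (at'-ι i))) (trans lb (cong label at'-p))))
  ... | inj₁ (i , i<L , refl) | inj₂ (inj₂ refl) = ⊥-elim (freshI i i<L (trans (sym (cong label (at'-ι i))) (trans lb (cong label at'-sp))))
  ... | inj₂ (inj₁ refl) | inj₁ (j , j<L , refl) = ⊥-elim (freshI j j<L (trans (sym (cong label (at'-ι j))) (trans (sym lb) (cong label at'-p))))
  ... | inj₂ (inj₂ refl) | inj₁ (j , j<L , refl) = ⊥-elim (freshI j j<L (trans (sym (cong label (at'-ι j))) (trans (sym lb) (cong label at'-sp))))
  ... | inj₂ (inj₁ refl) | inj₂ (inj₁ refl) = ⊥-elim (<-irrefl refl i'<j')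
  ... | inj₂ (inj₂ refl) | inj₂ (inj₂ refl) = ⊥-elim (<-irrefl refl i'<j')
  ... | inj₂ (inj₂ refl) | inj₂ (inj₁ refl) = ⊥-elim (<-asym i'<j' (n<1+n p))
  ... | inj₂ (inj₁ refl) | inj₂ (inj₂ refl) =
        subst₂ (λ a b → (delta a ≢ delta b) × Coherent (st a) (st b)) (sym at'-p) (sym at'-sp) (≢not b , coh)

  wfi' : WFI w'
  wfi' = twice' , compat'

setSt-kink : ∀ u (x y : Letter) v t t' → setSt (setSt (u ++ x ∷ y ∷ v) (length u) t) (suc (length u)) t' ≡
             u ++ mkL (label x) (delta x) t ∷ mkL (label y) (delta y) t' ∷ v
setSt-kink [] x y v t t' = refl
setSt-kink (z ∷ u) x y v t t' = cong (z ∷_) (setSt-kink u x y v t t')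

shape-setSt : ∀ w i s → Shape w (setSt w i s)
shape-setSt [] i s = []ₛ
shape-setSt (x ∷ w) zero s = (refl , refl) ∷ₛ shape-refl w
shape-setSt (x ∷ w) (suc i) s = (refl , refl) ∷ₛ shape-setSt w i s

resolve-shape : ∀ {w w'} → Resolve w w' → Shape w w'
resolve-shape {w} r with resolve→idx r
... | mkRI i j s s' _ _ _ _ _ _ _ refl = shape-trans (shape-setSt w i s) (shape-setSt (setSt w i s) j s')

module InsertResolve (u v : Word) (c : ℕ) (b : Bool) (s s' : Status) (fr : countLabel c (u ++ v) ≡ 0) where
  open InsertKink u v c b s s'
  freshI : ∀ i → i < L → label (at w i) ≢ c
  freshI = fresh-at c w fr
  lenL' : ∀ {i} → i < suc (suc L) → i < length w'
  lenL' = subst (_ <_) (sym lenw')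
  len'< : ∀ {i} → i < length w' → i < suc (suc L)
  len'< = subst (_ <_) lenw'

  lift-eq : ∀ i j t t' → Σ Word λ u₂ → Σ Word λ v₂ →
            setSt (setSt w i t) j t' ≡ u₂ ++ v₂ × setSt (setSt w' (ι i) t) (ι j) t' ≡ u₂ ++ K1 ∷ K2 ∷ v₂
  lift-eq i j t t' with setSt-ins u v K1 K2 i t
  ... | u₁ , v₁ , l₁ , e₁ , e₁' with setSt-ins u₁ v₁ K1 K2 j t'
  ... | u₂ , v₂ , l₂ , e₂ , e₂' = u₂ , v₂ , trans (cong (λ z → setSt z j t') e₁) e₂ ,
        trans (cong (λ z → setSt z (ι j) t') e₁') (trans (cong (λ n → setSt (u₁ ++ K1 ∷ K2 ∷ v₁) (bump n j) t') (sym l₁)) e₂')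

  lift : ∀ r → Resolve w r → Σ Word λ r' → Resolve w' r' × InsRel c b s s' r r'
  lift r rs with resolve→idx rs
  ... | mkRI i j t t' i<j j<L lab sti stj coh ne refl with lift-eq i j t t'
  ... | u₂ , v₂ , e , e' = _ , subst (Resolve w') e' rr , mkIR u₂ v₂ e refl fresh'
    where
      rr = idx→resolve w' (ι i) (ι j) t t' (bump-mono p i j i<j) (lenL' (ι-bound j j<L))
             (trans (cong label (at'-ι i)) (trans lab (sym (cong label (at'-ι j)))))
             (trans (cong st (at'-ι i)) sti) (trans (cong st (at'-ι j)) stj) coh ne
      fresh' : countLabel c (setSt (setSt w i t) j t') ≡ 0
      fresh' = trans (count-setSt c (setSt w i t) j t') (trans (count-setSt c w i t) fr)

  data KinkedMove (r' : Word) : Set where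
    qmove : ∀ r → Resolve w r → InsRel c b s s' r r' → KinkedMove r'
    kmove : s ≡ unres → s' ≡ unres → ∀ t t' → Coherent t t' → t ≢ unres →
            r' ≡ u ++ mkL c b t ∷ mkL c (not b) t' ∷ v → KinkedMove r'

  classify : ∀ r' → Resolve w' r' → KinkedMove r'
  classify r' rs with resolve→idx rs
  ... | mkRI i' j' t t' i'<j' j'< lab sti stj coh ne refl with view i' (len'< (<-trans i'<j' j'<)) | view j' (len'< j'<)
  ... | inj₁ (i , i<L , refl) | inj₁ (j , j<L , refl) with lift-eq i j t t'
  ...   | u₂ , v₂ , e , e' = qmove _ rr (mkIR u₂ v₂ e e' fresh')
    where
      rr = idx→resolve w i j t t' (bump-reflects-< p i j i'<j') j<L
             (trans (sym (cong label (at'-ι i))) (trans lab (cong label (at'-ι j))))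
             (trans (sym (cong st (at'-ι i))) sti) (trans (sym (cong st (at'-ι j))) stj) coh ne
      fresh' : countLabel c (setSt (setSt w i t) j t') ≡ 0
      fresh' = trans (count-setSt c (setSt w i t) j t') (trans (count-setSt c w i t) fr)
  classify r' rs | mkRI i' j' t t' i'<j' j'< lab sti stj coh ne refl | inj₁ (i , i<L , refl) | inj₂ (inj₁ refl) =
    ⊥-elim (freshI i i<L (trans (sym (cong label (at'-ι i))) (trans lab (cong label at'-p))))
  classify r' rs | mkRI i' j' t t' i'<j' j'< lab sti stj coh ne refl | inj₁ (i , i<L , refl) | inj₂ (inj₂ refl) =
    ⊥-elim (freshI i i<L (trans (sym (cong label (at'-ι i))) (trans lab (cong label at'-sp))))
  classify r' rs | mkRI i' j' t t' i'<j' j'< lab sti stj coh ne refl | inj₂ (inj₁ refl) | inj₁ (j , j<L , refl) =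
    ⊥-elim (freshI j j<L (trans (sym (cong label (at'-ι j))) (trans (sym lab) (cong label at'-p))))
  classify r' rs | mkRI i' j' t t' i'<j' j'< lab sti stj coh ne refl | inj₂ (inj₂ refl) | inj₁ (j , j<L , refl) =
    ⊥-elim (freshI j j<L (trans (sym (cong label (at'-ι j))) (trans (sym lab) (cong label at'-sp))))
  classify r' rs | mkRI i' j' t t' i'<j' j'< lab sti stj coh ne refl | inj₂ (inj₁ refl) | inj₂ (inj₁ refl) =
    ⊥-elim (<-irrefl refl i'<j')
  classify r' rs | mkRI i' j' t t' i'<j' j'< lab sti stj coh ne refl | inj₂ (inj₂ refl) | inj₂ (inj₂ refl) =
    ⊥-elim (<-irrefl refl i'<j')
  classify r' rs | mkRI i' j' t t' i'<j' j'< lab sti stj coh ne refl | inj₂ (inj₂ refl) | inj₂ (inj₁ refl) =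
    ⊥-elim (<-asym i'<j' (n<1+n p))
  classify r' rs | mkRI i' j' t t' i'<j' j'< lab sti stj coh ne refl | inj₂ (inj₁ refl) | inj₂ (inj₂ refl) =
    kmove (trans (sym (cong st at'-p)) sti) (trans (sym (cong st at'-sp)) stj) t t' coh ne (setSt-kink u K1 K2 v t t')

  kink-move : s ≡ unres → s' ≡ unres → ∀ t t' → Coherent t t' → t ≢ unres →
              Resolve w' (u ++ mkL c b t ∷ mkL c (not b) t' ∷ v)
  kink-move refl refl t t' coh ne = res u [] v K1 K2 t t' refl refl refl coh ne

  unresolved : s ≡ unres → ¬ Resolved w'
  unresolved e rv with ++⁻ʳ u rv
  ... | K1-resolved ∷ _ = K1-resolved e

  resolved-split : Resolved w' → Resolved w
  resolved-split rv = ++⁺ (++⁻ˡ u rv) (ps (++⁻ʳ u rv))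
    where
      ps : All (λ x → st x ≢ unres) (K1 ∷ K2 ∷ v) → All (λ x → st x ≢ unres) v
      ps (_ ∷ _ ∷ a) = a

  resolved-join : Resolved w → s ≢ unres → s' ≢ unres → Resolved w'
  resolved-join rv n n' = ++⁺ (++⁻ˡ u rv) (n ∷ n' ∷ ++⁻ʳ u rv)

  r1move : Move w' w
  r1move = r1 u v K1 K2 refl

data KinkState : Set where
  pending settled : KinkState

KinkIs : KinkState → Status → Status → Set
KinkIs pending s s' = s ≡ unres × s' ≡ unres
KinkIs settled s s' = Coherent s s' × s ≢ unres

kink-coherent : ∀ {k s s'} → KinkIs k s s' → Coherent s s'
kink-coherent {pending} (refl , refl) = uu
kink-coherent {settled} (c , _) = c

unres⇒pending : ∀ {k s s'} → KinkIs k s s' → s ≡ unres → k ≡ pending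
unres⇒pending {pending} _ _ = refl
unres⇒pending {settled} (_ , ne) e = ⊥-elim (ne e)

coherent-resolved : ∀ {s s'} → Coherent s s' → s ≢ unres → s' ≢ unres
coherent-resolved ou _ ()
coherent-resolved uo _ ()
coherent-resolved uu ne _ = ne refl

record KinkPair (Q Q₂ : Word) (k₁ k₂ : KinkState) : Set where
  constructor mkPair
  field
    Q₁ : Word
    c₁ c₂ : ℕ
    b₁ b₂ : Bool
    s₁ s₁' s₂ s₂' : Status
    ir₁ : InsRel c₁ b₁ s₁ s₁' Q Q₁
    ir₂ : InsRel c₂ b₂ s₂ s₂' Q₁ Q₂
    ks₁ : KinkIs k₁ s₁ s₁'
    ks₂ : KinkIs k₂ s₂ s₂'
    wfQ : WFI Q
    plQ : Planar Q
    plQ₁ : Planar Q₁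
    plQ₂ : Planar Q₂

liftIR : ∀ {c b s s' q q' r} → InsRel c b s s' q q' → Resolve q r → Σ Word λ r' → Resolve q' r' × InsRel c b s s' r r'
liftIR {c} {b} {s} {s'} (mkIR u v refl refl fr) rs = InsertResolve.lift u v c b s s' fr _ rs

data InsMove (c : ℕ) (b : Bool) (s s' : Status) (q : Word) (r' : Word) : Set where
  baseMove : ∀ r → Resolve q r → InsRel c b s s' r r' → InsMove c b s s' q r'
  kinkMove : s ≡ unres → s' ≡ unres → ∀ t t' → Coherent t t' → t ≢ unres → InsRel c b t t' q r' → InsMove c b s s' q r'

classifyIR : ∀ {c b s s' q q' r'} → InsRel c b s s' q q' → Resolve q' r' → InsMove c b s s' q r'
classifyIR {c} {b} {s} {s'} (mkIR u v refl refl fr) rs with InsertResolve.classify u v c b s s' fr _ rs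
... | InsertResolve.qmove r x y = baseMove r x y
... | InsertResolve.kmove e e' t t' coh ne eq = kinkMove e e' t t' coh ne (mkIR u v refl eq fr)

kinkIR : ∀ {c b q q'} → InsRel c b unres unres q q' → ∀ t t' → Coherent t t' → t ≢ unres →
         Σ Word λ r' → Resolve q' r' × InsRel c b t t' q r'
kinkIR {c} {b} (mkIR u v refl refl fr) t t' coh ne =
  _ , InsertResolve.kink-move u v c b unres unres fr refl refl t t' coh ne , mkIR u v refl refl fr

unresIR : ∀ {c b s s' q q'} → InsRel c b s s' q q' → s ≡ unres → ¬ Resolved q'
unresIR {c} {b} {s} {s'} (mkIR u v refl refl fr) e = InsertResolve.unresolved u v c b s s' fr e

splitIR : ∀ {c b s s' q q'} → InsRel c b s s' q q' → Resolved q' → Resolved q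
splitIR {c} {b} {s} {s'} (mkIR u v refl refl fr) = InsertResolve.resolved-split u v c b s s' fr

joinIR : ∀ {c b s s' q q'} → InsRel c b s s' q q' → Resolved q → s ≢ unres → s' ≢ unres → Resolved q'
joinIR {c} {b} {s} {s'} (mkIR u v refl refl fr) = InsertResolve.resolved-join u v c b s s' fr

moveIR : ∀ {c b s s' q q'} → InsRel c b s s' q q' → Move q' q
moveIR {c} {b} {s} {s'} (mkIR u v refl refl fr) = InsertResolve.r1move u v c b s s' fr

wfiIR : ∀ {c b s s' q q'} → InsRel c b s s' q q' → WFI q → Coherent s s' → WFI q'
wfiIR {c} {b} {s} {s'} (mkIR u v refl refl fr) w coh = InsertWF.wfi' u v c b s s' w fr coh

planarIR : ∀ {c b s s' q q'} → InsRel c b s s' q q' → Coherent s s' → WFI q → Planar q → Planar q'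
planarIR ir@(mkIR u v refl refl fr) coh wfi =
  planar-ins u v _ _ _ _ (twiceI→two (u ++ v) (proj₁ wfi)) (twiceI→two (u ++ _ ∷ _ ∷ v) (proj₁ (wfiIR ir wfi coh)))

resolve-planar : ∀ {w w'} → Resolve w w' → Planar w → Planar w'
resolve-planar r = shape-planar (resolve-shape r)

module _ {Q Q₂ : Word} {k₁ k₂ : KinkState} (st : KinkPair Q Q₂ k₁ k₂) where
  open KinkPair st

  liftPair : ∀ {Q'} → Resolve Q Q' → Σ Word λ Q₂' → Resolve Q₂ Q₂' × KinkPair Q' Q₂' k₁ k₂
  liftPair {Q'} rs with liftIR ir₁ rs
  ... | Q₁' , rs₁ , ir₁' with liftIR ir₂ rs₁
  ... | Q₂' , rs₂ , ir₂' = Q₂' , rs₂ ,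
        mkPair Q₁' c₁ c₂ b₁ b₂ s₁ s₁' s₂ s₂' ir₁' ir₂' ks₁ ks₂ (resolve-WFI wfQ rs)
             (resolve-planar rs plQ) (resolve-planar rs₁ plQ₁) (resolve-planar rs₂ plQ₂)

  data PairMove (w' : Word) : Set where
    inBase : ∀ Q' → Resolve Q Q' → KinkPair Q' w' k₁ k₂ → PairMove w'
    onKink₁ : k₁ ≡ pending → KinkPair Q w' settled k₂ → PairMove w'
    onKink₂ : k₂ ≡ pending → KinkPair Q w' k₁ settled → PairMove w'

  classifyPair : ∀ w' → Resolve Q₂ w' → PairMove w'
  classifyPair w' rs with classifyIR ir₂ rs
  ... | kinkMove e e' t t' coh ne ir₂' =
        onKink₂ (unres⇒pending ks₂ e) (mkPair Q₁ c₁ c₂ b₁ b₂ s₁ s₁' t t' ir₁ ir₂' ks₁ (coh , ne) wfQ plQ plQ₁ (resolve-planar rs plQ₂))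
  ... | baseMove r rs₁ ir₂' with classifyIR ir₁ rs₁
  ...   | baseMove Q' rsQ ir₁' = inBase Q' rsQ (mkPair r c₁ c₂ b₁ b₂ s₁ s₁' s₂ s₂' ir₁' ir₂' ks₁ ks₂ (resolve-WFI wfQ rsQ)
                              (resolve-planar rsQ plQ) (resolve-planar rs₁ plQ₁) (resolve-planar rs plQ₂))
  ...   | kinkMove e e' t t' coh ne ir₁' = onKink₁ (unres⇒pending ks₁ e) (mkPair r c₁ c₂ b₁ b₂ t t' s₂ s₂' ir₁' ir₂' (coh , ne) ks₂ wfQ plQ
                              (resolve-planar rs₁ plQ₁) (resolve-planar rs plQ₂))

  resolveKink₂ : k₂ ≡ pending → Σ Word λ w' → Resolve Q₂ w' × KinkPair Q w' k₁ settled
  resolveKink₂ refl with ks₂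
  ... | refl , refl with kinkIR ir₂ over under ou (λ ())
  ...   | w' , rs , ir₂' = w' , rs , mkPair Q₁ c₁ c₂ b₁ b₂ s₁ s₁' over under ir₁ ir₂' ks₁ (ou , (λ ())) wfQ plQ plQ₁ (resolve-planar rs plQ₂)

  resolveKink₁ : k₁ ≡ pending → Σ Word λ w' → Resolve Q₂ w' × KinkPair Q w' settled k₂
  resolveKink₁ refl with ks₁
  ... | refl , refl with kinkIR ir₁ over under ou (λ ())
  ...   | Q₁' , rs₁ , ir₁' with liftIR ir₂ rs₁
  ...     | w' , rs , ir₂' = w' , rs , mkPair Q₁' c₁ c₂ b₁ b₂ over under s₂ s₂' ir₁' ir₂' (ou , (λ ())) ks₂ wfQ plQ
                                 (resolve-planar rs₁ plQ₁) (resolve-planar rs plQ₂)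

  resolved-pair : Resolved Q₂ → Resolved Q × k₁ ≡ settled × k₂ ≡ settled
  resolved-pair rv = splitIR ir₁ rv₁ , kR ks₁ ir₁ rv₁ , kR ks₂ ir₂ rv
    where
      rv₁ = splitIR ir₂ rv
      kR : ∀ {k c b s s' q q'} → KinkIs k s s' → InsRel c b s s' q q' → Resolved q' → k ≡ settled
      kR {pending} (e , _) ir r = ⊥-elim (unresIR ir e r)
      kR {settled} _ _ _ = refl

  pending₁⇒unresolved : k₁ ≡ pending → ¬ Resolved Q₂
  pending₁⇒unresolved e rv with resolved-pair rv
  ... | _ , r , _ = case (trans (sym e) r)
    where case : pending ≡ settled → ⊥
          case ()

  pending₂⇒unresolved : k₂ ≡ pending → ¬ Resolved Q₂
  pending₂⇒unresolved e rv with resolved-pair rv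
  ... | _ , _ , r = case (trans (sym e) r)
    where case : pending ≡ settled → ⊥
          case ()

  unresolved-base : ¬ Resolved Q → ¬ Resolved Q₂
  unresolved-base n rv = n (proj₁ (resolved-pair rv))

module BothSettled {Q Q₂ : Word} (st : KinkPair Q Q₂ settled settled) (rQ : Resolved Q) where
  open KinkPair st

  settled-ne : ∀ {s s'} → KinkIs settled s s' → s ≢ unres × s' ≢ unres
  settled-ne (c , ne) = ne , coherent-resolved c ne

  rQ₁ : Resolved Q₁
  rQ₁ = joinIR ir₁ rQ (proj₁ (settled-ne ks₁)) (proj₂ (settled-ne ks₁))
  rQ₂ : Resolved Q₂
  rQ₂ = joinIR ir₂ rQ₁ (proj₁ (settled-ne ks₂)) (proj₂ (settled-ne ks₂))
  wf₁ : WFI Q₁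
  wf₁ = wfiIR ir₁ wfQ (kink-coherent {settled} ks₁)
  wf₂ : WFI Q₂
  wf₂ = wfiIR ir₂ wf₁ (kink-coherent {settled} ks₂)
  kd : KnotDiagram Q
  kd = (WFI→WF Q wfQ , plQ) , rQ
  kd₁ : KnotDiagram Q₁
  kd₁ = (WFI→WF Q₁ wf₁ , plQ₁) , rQ₁
  kd₂ : KnotDiagram Q₂
  kd₂ = (WFI→WF Q₂ wf₂ , plQ₂) , rQ₂
  unk→ : IsUnknot Q → IsUnknot Q₂
  unk→ p = (kd₂ , kd₁ , inj₁ (moveIR ir₂)) ◅ ((kd₁ , kd , inj₁ (moveIR ir₁)) ◅ p)
  unk← : IsUnknot Q₂ → IsUnknot Q
  unk← p = (kd , kd₁ , inj₂ (moveIR ir₁)) ◅ ((kd₁ , kd₂ , inj₂ (moveIR ir₂)) ◅ p)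

noMove : ∀ {w w'} → Resolved w → Resolve w w' → ⊥
noMove rv rs with resolve→idx rs
... | mkRI i j _ _ i<j j<L _ sti _ _ _ _ = all-at rv i (<-trans i<j j<L) sti

resolved? : ∀ w → Dec (Resolved w)
resolved? w = all? st-dec w
  where
    st-dec : ∀ x → Dec (st x ≢ unres)
    st-dec x with st x
    ... | unres = no (λ f → f refl)
    ... | over = yes (λ ())
    ... | under = yes (λ ())

-- The game seen by one player whose goal on finished diagrams is G:
-- Wins G mine w / Wins G theirs w says that this player wins from w when
-- it is their own / their opponent's turn.

data Turn : Set where
  mine theirs : Turn

data Wins (G : Word → Set) : Turn → Word → Set where
  finished : ∀ {t w} → Resolved w → G w → Wins G t w
  play     : ∀ {w} w' → Resolve w w' → Wins G theirs w' → Wins G mine w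
  answer   : ∀ {w} → ¬ Resolved w → (∀ w' → Resolve w w' → Wins G mine w') → Wins G theirs w

wins-resolved : ∀ {G t w} → Resolved w → Wins G t w → G w
wins-resolved _ (finished _ g) = g
wins-resolved rw (play _ rs _) = ⊥-elim (noMove rw rs)
wins-resolved rw (answer nr _) = ⊥-elim (nr rw)

Invariant : (Word → Set) → Set
Invariant G = ∀ {Q Q₂} → KinkPair Q Q₂ settled settled → Resolved Q → (G Q → G Q₂) × (G Q₂ → G Q)

unknot-invariant : Invariant IsUnknot
unknot-invariant st rQ = BothSettled.unk→ st rQ , BothSettled.unk← st rQ

¬-invariant : ∀ {G} → Invariant G → Invariant (λ w → ¬ G w)
¬-invariant inv st rQ = (λ n g → n (proj₂ (inv st rQ) g)) , (λ n g → n (proj₁ (inv st rQ) g))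

-- While both kinks
-- are settled, moves of Q and Q₂ correspond one to one.  While both are
-- pending, a player copies the winning strategy of Q and answers a move on
-- one kink by resolving the other (the pairing strategy); a move forced on a
-- finished Q is likewise spent on a kink.
module Transfer (G : Word → Set) (inv : Invariant G) where

  forwardS : ∀ {t Q Q₂} → Wins G t Q → KinkPair Q Q₂ settled settled → Wins G t Q₂
  forwardS (finished rQ g) st = finished (BothSettled.rQ₂ st rQ) (proj₁ (inv st rQ) g)
  forwardS (play Q' rs w) st with liftPair st rs
  ... | Q₂' , rs₂ , st' = play Q₂' rs₂ (forwardS w st')
  forwardS (answer nres h) st = answer (unresolved-base st nres) reply
    where
      reply : ∀ w' → Resolve _ w' → Wins G mine w'
      reply w' rs with classifyPair st w' rs
      ... | inBase Q' rsQ st' = forwardS (h Q' rsQ) st'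

  backwardS : ∀ {t Q Q₂} → Wins G t Q₂ → KinkPair Q Q₂ settled settled → Wins G t Q
  backwardS (finished rQ₂ g) st = finished rQ (proj₂ (inv st rQ) g)
    where rQ = proj₁ (resolved-pair st rQ₂)
  backwardS (play w' rs w) st with classifyPair st w' rs
  ... | inBase Q' rsQ st' = play Q' rsQ (backwardS w st')
  backwardS (answer nres h) st = answer (λ rQ → nres (BothSettled.rQ₂ st rQ)) reply
    where
      reply : ∀ Q' → Resolve _ Q' → Wins G mine Q'
      reply Q' rsQ with liftPair st rsQ
      ... | Q₂' , rs₂ , st' = backwardS (h Q₂' rs₂) st'

  forwardP : ∀ {t Q Q₂} → Wins G t Q → KinkPair Q Q₂ pending pending → Wins G t Q₂
  forwardP {mine} (finished rQ g) st with resolveKink₁ st refl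
  ... | w₁ , rs₁ , st₁ = play w₁ rs₁ (answer (pending₂⇒unresolved st₁ refl) reply)
    where
      reply : ∀ w' → Resolve w₁ w' → Wins G mine w'
      reply w' rs with classifyPair st₁ w' rs
      ... | inBase Q' rsQ _ = ⊥-elim (noMove rQ rsQ)
      ... | onKink₂ _ st₂ = forwardS (finished rQ g) st₂
  forwardP {theirs} (finished rQ g) st = answer (pending₁⇒unresolved st refl) reply
    where
      reply : ∀ w' → Resolve _ w' → Wins G mine w'
      reply w' rs with classifyPair st w' rs
      ... | inBase Q' rsQ _ = ⊥-elim (noMove rQ rsQ)
      ... | onKink₁ _ st₁ with resolveKink₂ st₁ refl
      ...   | w'' , rs'' , st'' = play w'' rs'' (forwardS (finished rQ g) st'')
      reply w' rs | onKink₂ _ st₁ with resolveKink₁ st₁ refl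
      ...   | w'' , rs'' , st'' = play w'' rs'' (forwardS (finished rQ g) st'')
  forwardP (play Q' rs w) st with liftPair st rs
  ... | Q₂' , rs₂ , st' = play Q₂' rs₂ (forwardP w st')
  forwardP (answer nres h) st = answer (unresolved-base st nres) reply
    where
      reply : ∀ w' → Resolve _ w' → Wins G mine w'
      reply w' rs with classifyPair st w' rs
      ... | inBase Q' rsQ st' = forwardP (h Q' rsQ) st'
      ... | onKink₁ _ st₁ with resolveKink₂ st₁ refl
      ...   | w'' , rs'' , st'' = play w'' rs'' (forwardS (answer nres h) st'')
      reply w' rs | onKink₂ _ st₁ with resolveKink₁ st₁ refl
      ...   | w'' , rs'' , st'' = play w'' rs'' (forwardS (answer nres h) st'')

  backwardP : ∀ {t Q Q₂} → Wins G t Q₂ → KinkPair Q Q₂ pending pending → Wins G t Q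
  backwardP (finished rQ₂ _) st = ⊥-elim (pending₁⇒unresolved st refl rQ₂)
  backwardP (play w' rs w) st with classifyPair st w' rs
  ... | inBase Q' rsQ st' = play Q' rsQ (backwardP w st')
  ... | onKink₁ _ st₁ with w
  ...   | finished rv _ = ⊥-elim (pending₂⇒unresolved st₁ refl rv)
  ...   | answer _ h with resolveKink₂ st₁ refl
  ...     | w'' , rs'' , st'' = backwardS (h w'' rs'') st''
  backwardP (play w' rs w) st | onKink₂ _ st₁ with w
  ...   | finished rv _ = ⊥-elim (pending₁⇒unresolved st₁ refl rv)
  ...   | answer _ h with resolveKink₁ st₁ refl
  ...     | w'' , rs'' , st'' = backwardS (h w'' rs'') st''
  backwardP {Q = Q} (answer nres h) st with resolved? Q
  ... | no nQ = answer nQ reply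
    where
      reply : ∀ Q' → Resolve Q Q' → Wins G mine Q'
      reply Q' rsQ with liftPair st rsQ
      ... | Q₂' , rs₂ , st' = backwardP (h Q₂' rs₂) st'
  ... | yes rQ with resolveKink₁ st refl
  ...   | w₁ , rs₁ , st₁ = finished rQ (goal (h w₁ rs₁))
    where
      -- the opponent of a finished Q has to spend the last move on kink 2
      goal : Wins G mine w₁ → G Q
      goal (finished rv _) = ⊥-elim (pending₂⇒unresolved st₁ refl rv)
      goal (play w₂ rs₂ w₂win) with classifyPair st₁ w₂ rs₂
      ... | inBase Q' rsQ _ = ⊥-elim (noMove rQ rsQ)
      ... | onKink₂ _ st₂ = wins-resolved rQ (backwardS w₂win st₂)

  kinks-irrelevant : ∀ {t Q Q₂} → KinkPair Q Q₂ pending pending → Wins G t Q ⇔ Wins G t Q₂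
  kinks-irrelevant st = mk⇔ (λ w → forwardP w st) (λ w → backwardP w st)

unknotterTurn : Player → Turn
unknotterTurn unknotter = mine
unknotterTurn knotter = theirs

knotterTurn : Player → Turn
knotterTurn knotter = mine
knotterTurn unknotter = theirs

UWins→Wins : ∀ {p w} → UWins p w → Wins IsUnknot (unknotterTurn p) w
UWins→Wins (uEnd rw u) = finished rw u
UWins→Wins (uMove w' rs win) = play w' rs (UWins→Wins win)
UWins→Wins (kMove nr h) = answer nr (λ w' rs → UWins→Wins (h w' rs))

Wins→UWins : ∀ p {w} → Wins IsUnknot (unknotterTurn p) w → UWins p w
Wins→UWins unknotter (finished rw u) = uEnd rw u
Wins→UWins unknotter (play w' rs win) = uMove w' rs (Wins→UWins knotter win)
Wins→UWins knotter (finished rw u) = uEnd rw u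
Wins→UWins knotter (answer nr h) = kMove nr (λ w' rs → Wins→UWins unknotter (h w' rs))

KWins→Wins : ∀ {p w} → KWins p w → Wins (λ v → ¬ IsUnknot v) (knotterTurn p) w
KWins→Wins (kEnd rw nu) = finished rw nu
KWins→Wins (kMove w' rs win) = play w' rs (KWins→Wins win)
KWins→Wins (uMove nr h) = answer nr (λ w' rs → KWins→Wins (h w' rs))

Wins→KWins : ∀ p {w} → Wins (λ v → ¬ IsUnknot v) (knotterTurn p) w → KWins p w
Wins→KWins knotter (finished rw nu) = kEnd rw nu
Wins→KWins knotter (play w' rs win) = kMove w' rs (Wins→KWins unknotter win)
Wins→KWins unknotter (finished rw nu) = kEnd rw nu
Wins→KWins unknotter (answer nr h) = uMove nr (λ w' rs → Wins→KWins knotter (h w' rs))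

module _ {Q Q₂ : Word} (st : KinkPair Q Q₂ pending pending) where
  open Transfer

  unknotter-same : ∀ p → UWins p Q ⇔ UWins p Q₂
  unknotter-same p = mk⇔ (λ w → Wins→UWins p (Equivalence.to same (UWins→Wins w)))
                         (λ w → Wins→UWins p (Equivalence.from same (UWins→Wins w)))
    where
      same : Wins IsUnknot (unknotterTurn p) Q ⇔ Wins IsUnknot (unknotterTurn p) Q₂
      same = kinks-irrelevant IsUnknot unknot-invariant st

  knotter-same : ∀ p → KWins p Q ⇔ KWins p Q₂
  knotter-same p = mk⇔ (λ w → Wins→KWins p (Equivalence.to same (KWins→Wins w)))
                       (λ w → Wins→KWins p (Equivalence.from same (KWins→Wins w)))
    where
      same : Wins (λ v → ¬ IsUnknot v) (knotterTurn p) Q ⇔ Wins (λ v → ¬ IsUnknot v) (knotterTurn p) Q₂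
      same = kinks-irrelevant (λ v → ¬ IsUnknot v) (¬-invariant unknot-invariant) st

addKink→InsRel : ∀ {X Y} → AddKink X Y → Σ ℕ λ c → Σ Bool λ b → InsRel c b unres unres X Y
addKink→InsRel (addKink u v c b fr) = c , b , mkIR u v refl refl fr

initialPair : ∀ {P P₁ P₂} → Pseudodiagram P → AddKink P P₁ → AddKink P₁ P₂ → KinkPair P P₂ pending pending
initialPair {P} {P₁} {P₂} (wf , pl) ak₁ ak₂ with addKink→InsRel ak₁ | addKink→InsRel ak₂
... | c₁ , b₁ , ir₁ | c₂ , b₂ , ir₂ =
  mkPair _ c₁ c₂ b₁ b₂ unres unres unres unres ir₁ ir₂ (refl , refl) (refl , refl) wfi pl pl₁ pl₂
  where
    wfi : WFI P
    wfi = WF→WFI P wf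
    pl₁ : Planar P₁
    pl₁ = planarIR ir₁ uu wfi pl
    pl₂ : Planar P₂
    pl₂ = planarIR ir₂ uu (wfiIR ir₁ wfi uu) pl₁

corollary3p6 : ∀ (P P₁ P₂ : Word) → Pseudodiagram P →
               AddKink P P₁ → AddKink P₁ P₂ →
               ∀ (o : Outcome) → HasOutcome P o ⇔ HasOutcome P₂ o
corollary3p6 P P₁ P₂ pd ak₁ ak₂ = same-outcome
  where
    pair : KinkPair P P₂ pending pending
    pair = initialPair pd ak₁ ak₂
    u : ∀ p → UWins p P ⇔ UWins p P₂
    u = unknotter-same pair
    k : ∀ p → KWins p P ⇔ KWins p P₂
    k = knotter-same pair
    same-outcome : ∀ o → HasOutcome P o ⇔ HasOutcome P₂ o
    same-outcome U      = u unknotter ×-⇔ u knotter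
    same-outcome K      = k unknotter ×-⇔ k knotter
    same-outcome first  = u unknotter ×-⇔ k knotter
    same-outcome second = k unknotter ×-⇔ u knotter
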